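{- Let $B=\mathbb{Q}[[Y]]$ for a sequence of indeterminates $Y$ and let $F\in B[[q,t]]$ have no term of degree $0$ in $t$. Then \[ \mathbf{e}_q[-F(t)]_q=\big(\mathbf{E}_q[F(t)]^*_q\big)^{ -1}, \] or equivalently $\mathbf{E}_q[-F(t)]^*_q=\big(\mathbf{e}_q[F(t)]_q\big)^{ -1}$.
   Context: Compositions are computed in $\mathcal{A}[[t]]$, $\mathcal{A}=\mathbb{Q}((q))[[Y]]$. $[n]_q=1+\cdots+q^{n-1}$ ($n\ge1$), $[0]_q=0$, $[n]_q!=[1]_q\cdots[n]_q$, $[0]_q!=1$; $D_qF(t)=\frac{F(qt)-F(t)}{(q-1)t}$. For $F$ with zero constant term in $t$: $F^{[0]}=F^{[0]^*}=1$; for $k\ge1$, $F^{[k]}$ (resp. $F^{[k]^*}$) is the unique series with zero constant term in $t$ with $D_qF^{[k]}=[k]_qF^{[k-1]}D_qF$ (resp. $D_qF^{[k]^*}(t)=[k]_qq^{ -(k-1)}F^{[k-1]^*}(qt)D_qF(t)$). For $G(t)=\sum_kg_kt^k/[k]_q!$: $G[F]_q=\sum_kg_kF^{[k]}/[k]_q!$ and $G[F]^*_q=\sum_kg_kF^{[k]^*}/[k]_q!$. $\mathbf{e}_q(t)=\sum_{n\ge0}t^n/[n]_q!$, $\mathbf{E}_q(t)=\sum_{n\ge0}q^{\binom n2}t^n/[n]_q!$. -}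

module Defs where

open import Data.Nat using (ℕ; zero; suc; _+_; _*_; _∸_; _<ᵇ_)
open import Data.Nat.Combinatorics using (_C_)
open import Data.Bool using (if_then_else_)
open import Data.List using (List; []; _∷_; upTo; zipWith; foldr; map; concatMap)
open import Data.Product using (_×_; _,_)
import Data.Rational as Q
open Q using (ℚ; 0ℚ; 1ℚ)
open import Relation.Binary.PropositionalEquality using (_≡_)

-- ℚ[[q]] : power series in q with rational coefficients (n ↦ coeff of q^n)

Ser : Set
Ser = ℕ → ℚ

sumℚ : List ℚ → ℚ
sumℚ = foldr Q._+_ 0ℚ

convS : Ser → Ser → Ser
convS a b n = sumℚ (map (λ i → a i Q.* b (n ∸ i)) (upTo (suc n)))

shiftUp : ℕ → Ser → Ser
shiftUp zero    s n       = s n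
shiftUp (suc k) s zero    = 0ℚ
shiftUp (suc k) s (suc n) = shiftUp k s n

qpowS : ℕ → Ser
qpowS k = shiftUp k (λ { zero → 1ℚ ; (suc _) → 0ℚ })

qintS : ℕ → Ser
qintS k j = if j <ᵇ k then 1ℚ else 0ℚ

qfactS : ℕ → Ser
qfactS zero    = qpowS 0
qfactS (suc k) = convS (qfactS k) (qintS (suc k))

-- multiplicative inverse of a power series with constant term 1:
-- b 0 = 1,  b (n+1) = - Σ_{i=0}^{n} a (i+1) * b (n-i).
-- invList a n = b n ∷ b (n-1) ∷ ... ∷ b 0
invList : Ser → ℕ → List ℚ
invList a zero    = 1ℚ ∷ []
invList a (suc n) =
  Q.- sumℚ (zipWith (λ i b → a (suc i) Q.* b) (upTo (suc n)) (invList a n))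
  ∷ invList a n

invS : Ser → Ser
invS a n with invList a n
... | []    = 0ℚ
... | x ∷ _ = x

-- ℚ((q)) : Laurent series, represented as q^(-sh) * ser

record Laurent : Set where
  constructor laurent
  field
    sh  : ℕ
    ser : Ser
open Laurent public

_≈L_ : Laurent → Laurent → Set
a ≈L b = ∀ n → shiftUp (sh b) (ser a) n ≡ shiftUp (sh a) (ser b) n

_+L_ : Laurent → Laurent → Laurent
a +L b = laurent (sh a + sh b)
  (λ n → shiftUp (sh b) (ser a) n Q.+ shiftUp (sh a) (ser b) n)

_*L_ : Laurent → Laurent → Laurent
a *L b = laurent (sh a + sh b) (convS (ser a) (ser b))

-L_ : Laurent → Laurent
-L a = laurent (sh a) (λ n → Q.- ser a n)

0L 1L : Laurent
0L = laurent 0 (λ _ → 0ℚ)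
1L = laurent 0 (qpowS 0)

fromSer : Ser → Laurent
fromSer s = laurent 0 s

qpowL qinvpowL : ℕ → Laurent
qpowL k    = fromSer (qpowS k)
qinvpowL k = laurent k (qpowS 0)

-- [k]_q, 1/[k]_q (k ≥ 1), 1/[k]_q!
qintL qintInvL qfactInvL : ℕ → Laurent
qintL k     = fromSer (qintS k)
qintInvL k  = fromSer (invS (qintS k))
qfactInvL k = fromSer (invS (qfactS k))

-- Monomials in the countable family of indeterminates Y = (y₀, y₁, …):
-- an exponent list (e₀, e₁, …, e_r) denotes y₀^e₀ ⋯ y_r^e_r; lists that differ
-- by trailing zeros denote the same monomial, so coefficients are always read
-- at the canonical representative 'strip m'.

consS : ℕ → List ℕ → List ℕ
consS zero    []       = []
consS zero    (y ∷ ys) = zero ∷ y ∷ ys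
consS (suc x) ys       = suc x ∷ ys

strip : List ℕ → List ℕ
strip []       = []
strip (x ∷ xs) = consS x (strip xs)

splits : List ℕ → List (List ℕ × List ℕ)
splits []      = ([] , []) ∷ []
splits (k ∷ m) = concatMap
  (λ i → map (λ { (e , f) → (i ∷ e , (k ∸ i) ∷ f) }) (splits m))
  (upTo (suc k))

-- B = ℚ[[Y]] : coefficient of the monomial m is  b (strip m)
QY : Set
QY = List ℕ → ℚ

-- 𝒜 = ℚ((q))[[Y]] : coefficient of the monomial m is  a (strip m) ∈ ℚ((q))

𝒜 : Set
𝒜 = List ℕ → Laurent

_≈A_ : 𝒜 → 𝒜 → Set
a ≈A b = ∀ m → a (strip m) ≈L b (strip m)

sumA' : List Laurent → Laurent
sumA' = foldr _+L_ 0L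

_+A_ : 𝒜 → 𝒜 → 𝒜
(a +A b) m = a (strip m) +L b (strip m)

_*A_ : 𝒜 → 𝒜 → 𝒜
(a *A b) m = sumA' (map (λ { (e , f) → a (strip e) *L b (strip f) }) (splits m))

-A_ : 𝒜 → 𝒜
(-A a) m = -L a (strip m)

_·A_ : Laurent → 𝒜 → 𝒜
(c ·A a) m = c *L a (strip m)

0A 1A : 𝒜
0A m = 0L
1A m with strip m
... | []    = 1L
... | _ ∷ _ = 0L

sumA : List 𝒜 → 𝒜
sumA = foldr _+A_ 0A

-- 𝒜[[t]] : n ↦ coefficient of t^n

T : Set
T = ℕ → 𝒜

_≈T_ : T → T → Set
F ≈T G = ∀ n → F n ≈A G n

_*T_ : T → T → T
(F *T G) n = sumA (map (λ i → F i *A G (n ∸ i)) (upTo (suc n)))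

-T_ : T → T
(-T F) n = -A F n

_·T_ : Laurent → T → T
(c ·T F) n = c ·A F n

1T : T
1T zero    = 1A
1T (suc _) = 0A

Dq : T → T
Dq G n = qintL (suc n) ·A G (suc n)

-- the unique series with zero constant term whose D_q is H
Iq : T → T
Iq H zero    = 0A
Iq H (suc n) = qintInvL (suc n) ·A H n

dil : T → T
dil G n = qpowL n ·A G n

qpow : T → ℕ → T
qpow F zero    = 1T
qpow F (suc k) = Iq (qintL (suc k) ·T (qpow F k *T Dq F))

qpow* : T → ℕ → T
qpow* F zero    = 1T
qpow* F (suc k) =
  Iq ((qintL (suc k) *L qinvpowL k) ·T (dil (qpow* F k) *T Dq F))

-- G(t) = Σ g_k t^k/[k]_q!  (g given as k ↦ g_k).
-- The coefficient of t^n in Σ_k g_k F^[k]/[k]_q! only receives contributions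
-- from k ≤ n (F^[k] has t-order ≥ k when F has zero constant term).
comp : (ℕ → Laurent) → T → T
comp g F n = sumA (map (λ k → (g k *L qfactInvL k) ·A qpow F k n) (upTo (suc n)))

comp* : (ℕ → Laurent) → T → T
comp* g F n = sumA (map (λ k → (g k *L qfactInvL k) ·A qpow* F k n) (upTo (suc n)))

e-coeff E-coeff : ℕ → Laurent
e-coeff k = 1L
E-coeff k = qpowL (k C 2)

-- embedding of B[[q,t]] into 𝒜[[t]]; f n j m = coefficient of t^n q^j Y^m
BQT : Set
BQT = ℕ → ℕ → QY

embed : BQT → T
embed f n m = fromSer (λ j → f n j (strip m))

-- By the defining recursions of F^[k] and F^[k]^*, e_q[H] and E_q[G]^* satisfy
-- the q-difference equations D_q e_q[H] = e_q[H] · D_q H and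
-- D_q E_q[G]^* = E_q[G]^*(qt) · D_q G.  If D_q G + D_q H = 0, as for G = F and
-- H = -F, the product W = e_q[H] · E_q[G]^* therefore satisfies
--   W(t) - W(qt) = (1 - q) t (D_q e_q[H] · E_q[G]^*(qt) + e_q[H] · D_q E_q[G]^*)
--                = (1 - q) t e_q[H] E_q[G]^*(qt) (D_q H + D_q G) = 0,
-- that is (1 - q^n) W_n = 0 for every n ≥ 1.  As 1 - q^n is invertible in
-- ℚ((q)), W is its constant term 1.

module Submission where

open import Defs
open import Level using (0ℓ)
open import Algebra.Bundles using (CommutativeRing; RawRing)
open import Algebra.Morphism.Structures using (IsRingMonomorphism)
import Algebra.Morphism.RingMonomorphism as RingMonomorphism
import Algebra.Consequences.Setoid
import Algebra.Properties.CommutativeSemigroup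
import Algebra.Properties.Ring
open import Data.Nat using (ℕ; zero; suc; _∸_; _≤_; _<_; z≤n; s≤s; s≤s⁻¹) renaming (_+_ to _+ℕ_)
open import Data.Nat.Properties as ℕ using (≤-refl; ≤-<-trans; m≤n⇒m≤1+n; m≤n⇒m<n∨m≡n; m+[n∸m]≡n)
open import Data.Nat.Combinatorics using (_C_; nC1≡n; nCk+nC[k+1]≡[n+1]C[k+1])
open import Data.Nat.Tactic.RingSolver using (solve-∀)
open import Data.List using (List; []; _∷_; _++_; map; foldr; upTo; applyUpTo; zipWith; concatMap; length)
open import Data.List.Properties using (map-applyUpTo; map-++; map-∘; map-cong)
open import Data.Product using (_×_; _,_)
open import Data.Rational using (0ℚ; 1ℚ) renaming (_+_ to _+ℚ_; _*_ to _*ℚ_; -_ to -ℚ_)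
import Data.Rational.Properties as ℚ
open import Data.Rational.Solver using (module +-*-Solver)
open import Data.Sum using (inj₁; inj₂)
open import Data.Vec using (Vec; []; _∷_; toList; fromList)
open import Data.Vec.Properties using (toList∘fromList)
open import Function using (_∘_)
open import Relation.Binary.Bundles using (Setoid)
open import Relation.Binary.Core using (Rel)
open import Relation.Binary.Structures using (IsEquivalence)
open import Relation.Binary.PropositionalEquality as ≡ using (_≡_)
import Relation.Binary.Reasoning.Setoid

module _ {a ℓ₁ b ℓ₂} {R : RawRing a ℓ₁} (S : CommutativeRing b ℓ₂) {⟦_⟧}
         (mono : IsRingMonomorphism R (CommutativeRing.rawRing S) ⟦_⟧) where

  pullbackCommutativeRing : CommutativeRing a ℓ₁
  pullbackCommutativeRing = record
    { RawRing R
    ; isCommutativeRing =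
        RingMonomorphism.isCommutativeRing mono (CommutativeRing.isCommutativeRing S)
    }

module _ {a ℓ₁ b ℓ₂} {R : RawRing a ℓ₁} {S : RawRing b ℓ₂}
         (⟦_⟧ : RawRing.Carrier R → RawRing.Carrier S) where
  open RawRing R
  private module S = RawRing S

  mkIsRingMonomorphism :
    (∀ {x y} → x ≈ y → ⟦ x ⟧ S.≈ ⟦ y ⟧) →
    (∀ x y → ⟦ x + y ⟧ S.≈ ⟦ x ⟧ S.+ ⟦ y ⟧) → ⟦ 0# ⟧ S.≈ S.0# →
    (∀ x y → ⟦ x * y ⟧ S.≈ ⟦ x ⟧ S.* ⟦ y ⟧) → ⟦ 1# ⟧ S.≈ S.1# →
    (∀ x → ⟦ - x ⟧ S.≈ S.- ⟦ x ⟧) →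
    (∀ {x y} → ⟦ x ⟧ S.≈ ⟦ y ⟧ → x ≈ y) →
    IsRingMonomorphism R S ⟦_⟧
  mkIsRingMonomorphism cong +-homo 0#-homo *-homo 1#-homo -‿homo injective = record
    { isRingHomomorphism = record
      { isSemiringHomomorphism = record
        { isNearSemiringHomomorphism = record
          { +-isMonoidHomomorphism = record
            { isMagmaHomomorphism = record
              { isRelHomomorphism = record { cong = cong }
              ; homo = +-homo }
            ; ε-homo = 0#-homo }
          ; *-homo = *-homo }
        ; 1#-homo = 1#-homo }
      ; -‿homo = -‿homo }
    ; injective = injective
    }

-- A relation wrapped in a record, so that Agda can infer the related
-- elements from a proof.
record Wrap {a ℓ} {A : Set a} (_∼_ : Rel A ℓ) (x y : A) : Set ℓ where
  constructor wrap
  field unwrap : x ∼ y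
open Wrap public

module _ {c ℓ} (R : CommutativeRing c ℓ) where
  open CommutativeRing R

  wrapped : CommutativeRing c ℓ
  wrapped = pullbackCommutativeRing R
    (mkIsRingMonomorphism {R = record { RawRing rawRing ; _≈_ = Wrap _≈_ }} (λ x → x)
      unwrap (λ _ _ → refl) refl (λ _ _ → refl) refl (λ _ → refl) wrap)

module _ {c ℓ} (R : ℕ → CommutativeRing c ℓ) where
  private module R d = CommutativeRing (R d)

  Π-commutativeRing : CommutativeRing c ℓ
  Π-commutativeRing = record
    { Carrier = ∀ d → R.Carrier d
    ; _≈_ = λ x y → ∀ d → R._≈_ d (x d) (y d)
    ; _+_ = λ x y d → R._+_ d (x d) (y d)
    ; _*_ = λ x y d → R._*_ d (x d) (y d)
    ; -_ = λ x d → R.-_ d (x d)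
    ; 0# = λ d → R.0# d
    ; 1# = λ d → R.1# d
    ; isCommutativeRing = record
      { isRing = record
        { +-isAbelianGroup = record
          { isGroup = record
            { isMonoid = record
              { isSemigroup = record
                { isMagma = record
                  { isEquivalence = record
                    { refl = λ d → R.refl d
                    ; sym = λ p d → R.sym d (p d)
                    ; trans = λ p q d → R.trans d (p d) (q d) }
                  ; ∙-cong = λ p q d → R.+-cong d (p d) (q d) }
                ; assoc = λ x y z d → R.+-assoc d (x d) (y d) (z d) }
              ; identity = (λ x d → R.+-identityˡ d (x d)) , (λ x d → R.+-identityʳ d (x d)) }
            ; inverse = (λ x d → R.-‿inverseˡ d (x d)) , (λ x d → R.-‿inverseʳ d (x d))
            ; ⁻¹-cong = λ p d → R.-‿cong d (p d) }
          ; comm = λ x y d → R.+-comm d (x d) (y d) }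
        ; *-cong = λ p q d → R.*-cong d (p d) (q d)
        ; *-assoc = λ x y z d → R.*-assoc d (x d) (y d) (z d)
        ; *-identity = (λ x d → R.*-identityˡ d (x d)) , (λ x d → R.*-identityʳ d (x d))
        ; distrib = (λ x y z d → R.distribˡ d (x d) (y d) (z d))
                  , (λ x y z d → R.distribʳ d (x d) (y d) (z d)) }
      ; *-comm = λ x y d → R.*-comm d (x d) (y d) }
    }

module _ {c ℓ} (R : CommutativeRing c ℓ) where
  open CommutativeRing R
  open import Algebra.Properties.Ring ring using (-‿distribˡ-*; -‿distribʳ-*)
  open Relation.Binary.Reasoning.Setoid setoid

  *-difference : ∀ a b a′ b′ → a * b - a′ * b′ ≈ a * (b - b′) + (a - a′) * b′
  *-difference a b a′ b′ = sym (begin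
    a * (b - b′) + (a - a′) * b′
      ≈⟨ +-cong (distribˡ a b (- b′)) (distribʳ b′ a (- a′)) ⟩
    (a * b + a * - b′) + (a * b′ + - a′ * b′)
      ≈⟨ +-cong (+-congˡ (-‿distribʳ-* a b′)) (+-congˡ (-‿distribˡ-* a′ b′)) ⟨
    (a * b - a * b′) + (a * b′ - a′ * b′)
      ≈⟨ +-assoc _ _ _ ⟩
    a * b + (- (a * b′) + (a * b′ - a′ * b′))
      ≈⟨ +-congˡ (+-assoc _ _ _) ⟨
    a * b + ((- (a * b′) + a * b′) - a′ * b′)
      ≈⟨ +-congˡ (+-congʳ (-‿inverseˡ _)) ⟩
    a * b + (0# - a′ * b′)
      ≈⟨ +-congˡ (+-identityˡ _) ⟩
    a * b - a′ * b′
      ∎)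

-- Formal power series over a commutative ring

map-upTo-suc : ∀ {b} {B : Set b} (f : ℕ → B) n →
  map f (upTo (suc n)) ≡ f 0 ∷ map (f ∘ suc) (upTo n)
map-upTo-suc f n = ≡.cong (f 0 ∷_)
  (≡.trans (map-applyUpTo suc f n) (≡.sym (map-applyUpTo (λ i → i) (f ∘ suc) n)))

module PowerSeries {c ℓ} (R : CommutativeRing c ℓ) where
  open CommutativeRing R
  open import Relation.Binary.Reasoning.Setoid setoid
  open import Algebra.Properties.CommutativeSemigroup +-commutativeSemigroup
    using (interchange; x∙yz≈y∙xz)

  ∑ : ℕ → (ℕ → Carrier) → Carrier
  ∑ n f = foldr _+_ 0# (map f (upTo n))

  ∑-suc : ∀ n f → ∑ (suc n) f ≡ f 0 + ∑ n (f ∘ suc)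
  ∑-suc n f = ≡.cong (foldr _+_ 0#) (map-upTo-suc f n)

  ∑-cong-< : ∀ n {f g : ℕ → Carrier} → (∀ i → i < n → f i ≈ g i) → ∑ n f ≈ ∑ n g
  ∑-cong-< zero h = refl
  ∑-cong-< (suc n) {f} {g} h = begin
    ∑ (suc n) f
      ≡⟨ ∑-suc n f ⟩
    f 0 + ∑ n (f ∘ suc)
      ≈⟨ +-cong (h 0 (s≤s z≤n)) (∑-cong-< n (λ i p → h (suc i) (s≤s p))) ⟩
    g 0 + ∑ n (g ∘ suc)
      ≡⟨ ≡.sym (∑-suc n g) ⟩
    ∑ (suc n) g
      ∎

  ∑-cong : ∀ n {f g : ℕ → Carrier} → (∀ i → f i ≈ g i) → ∑ n f ≈ ∑ n g
  ∑-cong n h = ∑-cong-< n (λ i _ → h i)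

  ∑-snoc : ∀ n f → ∑ (suc n) f ≈ ∑ n f + f n
  ∑-snoc zero f = +-comm (f 0) 0#
  ∑-snoc (suc n) f = begin
    ∑ (suc (suc n)) f                     ≡⟨ ∑-suc (suc n) f ⟩
    f 0 + ∑ (suc n) (f ∘ suc)             ≈⟨ +-congˡ (∑-snoc n (f ∘ suc)) ⟩
    f 0 + (∑ n (f ∘ suc) + f (suc n))     ≈⟨ +-assoc _ _ _ ⟨
    (f 0 + ∑ n (f ∘ suc)) + f (suc n)     ≡⟨ ≡.cong (_+ f (suc n)) (≡.sym (∑-suc n f)) ⟩
    ∑ (suc n) f + f (suc n)               ∎

  ∑-extend : ∀ m n f → (∀ k → m ≤ k → f k ≈ 0#) → m ≤ n → ∑ m f ≈ ∑ n f
  ∑-extend m zero f h z≤n = refl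
  ∑-extend m (suc n) f h m≤1+n with m≤n⇒m<n∨m≡n m≤1+n
  ... | inj₂ ≡.refl = refl
  ... | inj₁ (s≤s m≤n) = begin
    ∑ m f          ≈⟨ ∑-extend m n f h m≤n ⟩
    ∑ n f          ≈⟨ +-identityʳ _ ⟨
    ∑ n f + 0#     ≈⟨ +-congˡ (h n m≤n) ⟨
    ∑ n f + f n    ≈⟨ ∑-snoc n f ⟨
    ∑ (suc n) f    ∎

  infixl 7 _⊛_
  _⊛_ : (ℕ → Carrier) → (ℕ → Carrier) → ℕ → Carrier
  (a ⊛ b) n = ∑ (suc n) (λ i → a i * b (n ∸ i))

  ⊛-suc : ∀ a b n → (a ⊛ b) (suc n) ≡ a 0 * b (suc n) + ((a ∘ suc) ⊛ b) n
  ⊛-suc a b n = ∑-suc (suc n) (λ i → a i * b (suc n ∸ i))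

  ⊛-cong-≤ : ∀ n {a a′ b b′ : ℕ → Carrier} →
    (∀ i → i ≤ n → a i ≈ a′ i) → (∀ i → i ≤ n → b i ≈ b′ i) → (a ⊛ b) n ≈ (a′ ⊛ b′) n
  ⊛-cong-≤ zero ha hb = +-congʳ (*-cong (ha 0 z≤n) (hb 0 z≤n))
  ⊛-cong-≤ (suc n) {a} {a′} {b} {b′} ha hb = begin
    (a ⊛ b) (suc n)                          ≡⟨ ⊛-suc a b n ⟩
    a 0 * b (suc n) + ((a ∘ suc) ⊛ b) n
      ≈⟨ +-cong (*-cong (ha 0 z≤n) (hb (suc n) ≤-refl))
                (⊛-cong-≤ n (λ i p → ha (suc i) (s≤s p)) (λ i p → hb i (m≤n⇒m≤1+n p))) ⟩
    a′ 0 * b′ (suc n) + ((a′ ∘ suc) ⊛ b′) n  ≡⟨ ≡.sym (⊛-suc a′ b′ n) ⟩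
    (a′ ⊛ b′) (suc n)                        ∎

  ⊛-cong : ∀ {a a′ b b′ : ℕ → Carrier} → (∀ i → a i ≈ a′ i) → (∀ i → b i ≈ b′ i) →
    ∀ n → (a ⊛ b) n ≈ (a′ ⊛ b′) n
  ⊛-cong ha hb n = ⊛-cong-≤ n (λ i _ → ha i) (λ i _ → hb i)

  ⊛-distribʳ : ∀ (a a′ b : ℕ → Carrier) n → ((λ i → a i + a′ i) ⊛ b) n ≈ (a ⊛ b) n + (a′ ⊛ b) n
  ⊛-distribʳ a a′ b zero = begin
    (a 0 + a′ 0) * b 0 + 0#                ≈⟨ +-identityʳ _ ⟩
    (a 0 + a′ 0) * b 0                     ≈⟨ distribʳ _ _ _ ⟩
    a 0 * b 0 + a′ 0 * b 0                 ≈⟨ +-cong (+-identityʳ _) (+-identityʳ _) ⟨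
    (a 0 * b 0 + 0#) + (a′ 0 * b 0 + 0#)   ∎
  ⊛-distribʳ a a′ b (suc n) = begin
    ((λ i → a i + a′ i) ⊛ b) (suc n)
      ≡⟨ ⊛-suc _ b n ⟩
    (a 0 + a′ 0) * b (suc n) + ((λ i → a (suc i) + a′ (suc i)) ⊛ b) n
      ≈⟨ +-cong (distribʳ _ _ _) (⊛-distribʳ (a ∘ suc) (a′ ∘ suc) b n) ⟩
    (a 0 * b (suc n) + a′ 0 * b (suc n)) + (((a ∘ suc) ⊛ b) n + ((a′ ∘ suc) ⊛ b) n)
      ≈⟨ interchange _ _ _ _ ⟩
    (a 0 * b (suc n) + ((a ∘ suc) ⊛ b) n) + (a′ 0 * b (suc n) + ((a′ ∘ suc) ⊛ b) n)
      ≡⟨ ≡.sym (≡.cong₂ _+_ (⊛-suc a b n) (⊛-suc a′ b n)) ⟩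
    (a ⊛ b) (suc n) + (a′ ⊛ b) (suc n)
      ∎

  ⊛-zeroˡ : ∀ (b : ℕ → Carrier) n → ((λ _ → 0#) ⊛ b) n ≈ 0#
  ⊛-zeroˡ b zero = trans (+-identityʳ _) (zeroˡ _)
  ⊛-zeroˡ b (suc n) = begin
    ((λ _ → 0#) ⊛ b) (suc n)                  ≡⟨ ⊛-suc _ b n ⟩
    0# * b (suc n) + ((λ _ → 0#) ⊛ b) n       ≈⟨ +-cong (zeroˡ _) (⊛-zeroˡ b n) ⟩
    0# + 0#                                   ≈⟨ +-identityʳ _ ⟩
    0#                                        ∎

  ⊛-comm : ∀ (a b : ℕ → Carrier) n → (a ⊛ b) n ≈ (b ⊛ a) n
  ⊛-comm a b zero = +-congʳ (*-comm _ _)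
  ⊛-comm a b (suc zero) = begin
    a 0 * b 1 + (a 1 * b 0 + 0#)   ≈⟨ +-congˡ (+-identityʳ _) ⟩
    a 0 * b 1 + a 1 * b 0          ≈⟨ +-comm _ _ ⟩
    a 1 * b 0 + a 0 * b 1          ≈⟨ +-cong (*-comm _ _) (*-comm _ _) ⟩
    b 0 * a 1 + b 1 * a 0          ≈⟨ +-congˡ (+-identityʳ _) ⟨
    b 0 * a 1 + (b 1 * a 0 + 0#)   ∎
  ⊛-comm a b (suc (suc m)) = begin
    (a ⊛ b) (suc (suc m))
      ≡⟨ ⊛-suc a b (suc m) ⟩
    a 0 * b (2+ m) + ((a ∘ suc) ⊛ b) (suc m)
      ≈⟨ +-congˡ (⊛-comm (a ∘ suc) b (suc m)) ⟩
    a 0 * b (2+ m) + (b ⊛ (a ∘ suc)) (suc m)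
      ≡⟨ ≡.cong (a 0 * b (2+ m) +_) (⊛-suc b (a ∘ suc) m) ⟩
    a 0 * b (2+ m) + (b 0 * a (2+ m) + ((b ∘ suc) ⊛ (a ∘ suc)) m)
      ≈⟨ +-congˡ (+-congˡ (⊛-comm (b ∘ suc) (a ∘ suc) m)) ⟩
    a 0 * b (2+ m) + (b 0 * a (2+ m) + ((a ∘ suc) ⊛ (b ∘ suc)) m)
      ≈⟨ x∙yz≈y∙xz _ _ _ ⟩
    b 0 * a (2+ m) + (a 0 * b (2+ m) + ((a ∘ suc) ⊛ (b ∘ suc)) m)
      ≡⟨ ≡.cong (b 0 * a (2+ m) +_) (≡.sym (⊛-suc a (b ∘ suc) m)) ⟩
    b 0 * a (2+ m) + (a ⊛ (b ∘ suc)) (suc m)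
      ≈⟨ +-congˡ (⊛-comm a (b ∘ suc) (suc m)) ⟩
    b 0 * a (2+ m) + ((b ∘ suc) ⊛ a) (suc m)
      ≡⟨ ≡.sym (⊛-suc b a (suc m)) ⟩
    (b ⊛ a) (suc (suc m))
      ∎
    where 2+ : ℕ → ℕ
          2+ m = suc (suc m)

  ⊛-distribˡ : ∀ (a b b′ : ℕ → Carrier) n → (a ⊛ (λ i → b i + b′ i)) n ≈ (a ⊛ b) n + (a ⊛ b′) n
  ⊛-distribˡ a b b′ n =
    trans (⊛-comm a _ n) (trans (⊛-distribʳ b b′ a n) (+-cong (⊛-comm b a n) (⊛-comm b′ a n)))

  ⊛-∑ˡ : ∀ N (h : ℕ → ℕ → Carrier) (b : ℕ → Carrier) n →
    ((λ i → ∑ N (λ k → h k i)) ⊛ b) n ≈ ∑ N (λ k → (h k ⊛ b) n)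
  ⊛-∑ˡ zero h b n = ⊛-zeroˡ b n
  ⊛-∑ˡ (suc N) h b n = begin
    ((λ i → ∑ (suc N) (λ k → h k i)) ⊛ b) n
      ≈⟨ ⊛-cong {b = b} {b′ = b} (λ i → reflexive (∑-suc N (λ k → h k i))) (λ _ → refl) n ⟩
    ((λ i → h 0 i + ∑ N (λ k → h (suc k) i)) ⊛ b) n
      ≈⟨ ⊛-distribʳ _ _ b n ⟩
    (h 0 ⊛ b) n + ((λ i → ∑ N (λ k → h (suc k) i)) ⊛ b) n
      ≈⟨ +-congˡ (⊛-∑ˡ N (h ∘ suc) b n) ⟩
    (h 0 ⊛ b) n + ∑ N (λ k → (h (suc k) ⊛ b) n)
      ≡⟨ ≡.sym (∑-suc N _) ⟩
    ∑ (suc N) (λ k → (h k ⊛ b) n)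
      ∎

  module Action {k} {K : Set k} (_•_ : K → Carrier → Carrier)
    (•-congˡ : ∀ s {x y} → x ≈ y → (s • x) ≈ (s • y))
    (•-+ : ∀ s x y → (s • (x + y)) ≈ (s • x) + (s • y))
    (•-0 : ∀ s → (s • 0#) ≈ 0#)
    (•-* : ∀ s x y → (s • (x * y)) ≈ (s • x) * y) where

    ∑-• : ∀ n s (f : ℕ → Carrier) → ∑ n (λ i → s • f i) ≈ s • ∑ n f
    ∑-• zero s f = sym (•-0 s)
    ∑-• (suc n) s f = begin
      ∑ (suc n) (λ i → s • f i)           ≡⟨ ∑-suc n _ ⟩
      s • f 0 + ∑ n (λ i → s • f (suc i)) ≈⟨ +-congˡ (∑-• n s (f ∘ suc)) ⟩
      s • f 0 + s • ∑ n (f ∘ suc)         ≈⟨ •-+ s _ _ ⟨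
      s • (f 0 + ∑ n (f ∘ suc))           ≡⟨ ≡.cong (s •_) (≡.sym (∑-suc n f)) ⟩
      s • ∑ (suc n) f                     ∎

    ⊛-•ˡ : ∀ s (a b : ℕ → Carrier) n → ((λ i → s • a i) ⊛ b) n ≈ s • (a ⊛ b) n
    ⊛-•ˡ s a b n = begin
      ∑ (suc n) (λ i → (s • a i) * b (n ∸ i))  ≈⟨ ∑-cong (suc n) (λ i → •-* s _ _) ⟨
      ∑ (suc n) (λ i → s • (a i * b (n ∸ i)))  ≈⟨ ∑-• (suc n) s _ ⟩
      s • (a ⊛ b) n                            ∎

  open Action _*_ (λ s → *-congˡ) distribˡ zeroʳ (λ s x y → sym (*-assoc s x y))
    using () renaming (⊛-•ˡ to ⊛-*ˡ)

  ⊛-assoc : ∀ (a b c : ℕ → Carrier) n → ((a ⊛ b) ⊛ c) n ≈ (a ⊛ (b ⊛ c)) n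
  ⊛-assoc a b c zero = begin
    (a 0 * b 0 + 0#) * c 0 + 0#    ≈⟨ +-congʳ (*-congʳ (+-identityʳ _)) ⟩
    (a 0 * b 0) * c 0 + 0#         ≈⟨ +-congʳ (*-assoc _ _ _) ⟩
    a 0 * (b 0 * c 0) + 0#         ≈⟨ +-congʳ (*-congˡ (+-identityʳ _)) ⟨
    a 0 * (b 0 * c 0 + 0#) + 0#    ∎
  ⊛-assoc a b c (suc n) = begin
    ((a ⊛ b) ⊛ c) (suc n)
      ≡⟨ ⊛-suc (a ⊛ b) c n ⟩
    (a ⊛ b) 0 * c (suc n) + (((a ⊛ b) ∘ suc) ⊛ c) n
      ≈⟨ +-congˡ (⊛-cong {b = c} {b′ = c} (λ i → reflexive (⊛-suc a b i)) (λ _ → refl) n) ⟩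
    (a ⊛ b) 0 * c (suc n) + ((λ i → a 0 * b (suc i) + ((a ∘ suc) ⊛ b) i) ⊛ c) n
      ≈⟨ +-congˡ (⊛-distribʳ _ _ c n) ⟩
    (a ⊛ b) 0 * c (suc n) + (((λ i → a 0 * b (suc i)) ⊛ c) n + (((a ∘ suc) ⊛ b) ⊛ c) n)
      ≈⟨ +-cong (*-congʳ (+-identityʳ _)) (+-cong (⊛-*ˡ (a 0) (b ∘ suc) c n) (⊛-assoc (a ∘ suc) b c n)) ⟩
    (a 0 * b 0) * c (suc n) + (a 0 * ((b ∘ suc) ⊛ c) n + ((a ∘ suc) ⊛ (b ⊛ c)) n)
      ≈⟨ +-assoc _ _ _ ⟨
    ((a 0 * b 0) * c (suc n) + a 0 * ((b ∘ suc) ⊛ c) n) + ((a ∘ suc) ⊛ (b ⊛ c)) n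
      ≈⟨ +-congʳ (trans (+-congʳ (*-assoc _ _ _)) (sym (distribˡ _ _ _))) ⟩
    a 0 * (b 0 * c (suc n) + ((b ∘ suc) ⊛ c) n) + ((a ∘ suc) ⊛ (b ⊛ c)) n
      ≡⟨ ≡.cong (λ z → a 0 * z + ((a ∘ suc) ⊛ (b ⊛ c)) n) (≡.sym (⊛-suc b c n)) ⟩
    a 0 * (b ⊛ c) (suc n) + ((a ∘ suc) ⊛ (b ⊛ c)) n
      ≡⟨ ≡.sym (⊛-suc a (b ⊛ c) n) ⟩
    (a ⊛ (b ⊛ c)) (suc n)
      ∎

  δ : ℕ → Carrier
  δ zero    = 1#
  δ (suc _) = 0#

  ⊛-identityˡ : ∀ (b : ℕ → Carrier) n → (δ ⊛ b) n ≈ b n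
  ⊛-identityˡ b zero = trans (+-identityʳ _) (*-identityˡ _)
  ⊛-identityˡ b (suc n) = begin
    (δ ⊛ b) (suc n)                       ≡⟨ ⊛-suc δ b n ⟩
    1# * b (suc n) + ((λ _ → 0#) ⊛ b) n   ≈⟨ +-cong (*-identityˡ _) (⊛-zeroˡ b n) ⟩
    b (suc n) + 0#                        ≈⟨ +-identityʳ _ ⟩
    b (suc n)                             ∎

  powerSeriesRing : CommutativeRing c ℓ
  powerSeriesRing = record
    { Carrier = ℕ → Carrier
    ; _≈_ = λ f g → ∀ n → f n ≈ g n
    ; _+_ = λ f g n → f n + g n
    ; _*_ = _⊛_
    ; -_ = λ f n → - f n
    ; 0# = λ _ → 0#
    ; 1# = δ
    ; isCommutativeRing = record
      { isRing = record
        { +-isAbelianGroup = record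
          { isGroup = record
            { isMonoid = record
              { isSemigroup = record
                { isMagma = record
                  { isEquivalence = record
                    { refl = λ n → refl ; sym = λ p n → sym (p n) ; trans = λ p q n → trans (p n) (q n) }
                  ; ∙-cong = λ p q n → +-cong (p n) (q n) }
                ; assoc = λ f g h n → +-assoc _ _ _ }
              ; identity = (λ f n → +-identityˡ _) , (λ f n → +-identityʳ _) }
            ; inverse = (λ f n → -‿inverseˡ _) , (λ f n → -‿inverseʳ _)
            ; ⁻¹-cong = λ p n → -‿cong (p n) }
          ; comm = λ f g n → +-comm _ _ }
        ; *-cong = ⊛-cong
        ; *-assoc = ⊛-assoc
        ; *-identity = ⊛-identityˡ , (λ b n → trans (⊛-comm b δ n) (⊛-identityˡ b n))
        ; distrib = ⊛-distribˡ , (λ a b b′ n → ⊛-distribʳ b b′ a n) }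
      ; *-comm = ⊛-comm } }

-- The ring ℚ((q))

ℚ-ring : CommutativeRing 0ℓ 0ℓ
ℚ-ring = ℚ.+-*-commutativeRing

module ℚSeries = PowerSeries ℚ-ring
module ℚ[[q]] = CommutativeRing ℚSeries.powerSeriesRing
module ≐-Reasoning = Relation.Binary.Reasoning.Setoid ℚ[[q]].setoid

infix 4 _≐_
_≐_ : Ser → Ser → Set
_≐_ = ℚ[[q]]._≈_

infixl 6 _⊕_
_⊕_ : Ser → Ser → Ser
_⊕_ = ℚ[[q]]._+_

shiftUp-at : ∀ k (x : Ser) n → shiftUp k x (k +ℕ n) ≡ x n
shiftUp-at zero    x n = ≡.refl
shiftUp-at (suc k) x n = shiftUp-at k x n

shiftUp-injective : ∀ k {x y : Ser} → shiftUp k x ≐ shiftUp k y → x ≐ y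
shiftUp-injective k {x} {y} p n =
  ≡.trans (≡.sym (shiftUp-at k x n)) (≡.trans (p (k +ℕ n)) (shiftUp-at k y n))

shiftUp-cong : ∀ k {x y : Ser} → x ≐ y → shiftUp k x ≐ shiftUp k y
shiftUp-cong zero    p n       = p n
shiftUp-cong (suc k) p zero    = ≡.refl
shiftUp-cong (suc k) p (suc n) = shiftUp-cong k p n

shiftUp-≡ : ∀ {a b} (x : Ser) → a ≡ b → shiftUp a x ≐ shiftUp b x
shiftUp-≡ x ≡.refl n = ≡.refl

shiftUp-shiftUp : ∀ a b (x : Ser) → shiftUp a (shiftUp b x) ≐ shiftUp (a +ℕ b) x
shiftUp-shiftUp zero    b x n       = ≡.refl
shiftUp-shiftUp (suc a) b x zero    = ≡.refl
shiftUp-shiftUp (suc a) b x (suc n) = shiftUp-shiftUp a b x n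

shiftUp-shiftUp-≡ : ∀ a b c d (x : Ser) → a +ℕ b ≡ c +ℕ d →
  shiftUp a (shiftUp b x) ≐ shiftUp c (shiftUp d x)
shiftUp-shiftUp-≡ a b c d x e = ℚ[[q]].trans (shiftUp-shiftUp a b x)
  (ℚ[[q]].trans (shiftUp-≡ x e) (ℚ[[q]].sym (shiftUp-shiftUp c d x)))

shiftUp-+ : ∀ k (x y : Ser) → shiftUp k (x ⊕ y) ≐ shiftUp k x ⊕ shiftUp k y
shiftUp-+ zero    x y n       = ≡.refl
shiftUp-+ (suc k) x y zero    = ≡.sym (ℚ.+-identityˡ 0ℚ)
shiftUp-+ (suc k) x y (suc n) = shiftUp-+ k x y n

shiftUp-neg : ∀ k (x : Ser) → shiftUp k (ℚ[[q]].- x) ≐ ℚ[[q]].- shiftUp k x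
shiftUp-neg zero    x n       = ≡.refl
shiftUp-neg (suc k) x zero    = ≡.refl
shiftUp-neg (suc k) x (suc n) = shiftUp-neg k x n

shiftUp-0 : ∀ k → shiftUp k ℚ[[q]].0# ≐ ℚ[[q]].0#
shiftUp-0 zero    n       = ≡.refl
shiftUp-0 (suc k) zero    = ≡.refl
shiftUp-0 (suc k) (suc n) = shiftUp-0 k n

shiftUp-convˡ : ∀ k (x y : Ser) → shiftUp k (convS x y) ≐ convS (shiftUp k x) y
shiftUp-convˡ zero    x y n = ≡.refl
shiftUp-convˡ (suc k) x y zero = ≡.sym (≡.trans (ℚ.+-identityʳ _) (ℚ.*-zeroˡ (y 0)))
shiftUp-convˡ (suc k) x y (suc n) = begin
  shiftUp k (convS x y) n                    ≡⟨ shiftUp-convˡ k x y n ⟩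
  convS (shiftUp k x) y n                    ≡⟨ ℚ.+-identityˡ _ ⟨
  0ℚ +ℚ convS (shiftUp k x) y n              ≡⟨ ≡.cong (_+ℚ convS (shiftUp k x) y n) (ℚ.*-zeroˡ (y (suc n))) ⟨
  0ℚ *ℚ y (suc n) +ℚ convS (shiftUp k x) y n
                                             ≡⟨ ℚSeries.⊛-suc (shiftUp (suc k) x) y n ⟨
  convS (shiftUp (suc k) x) y (suc n)        ∎
  where open ≡.≡-Reasoning

shiftUp-convʳ : ∀ k (x y : Ser) → shiftUp k (convS x y) ≐ convS x (shiftUp k y)
shiftUp-convʳ k x y = ℚ[[q]].trans (shiftUp-cong k (ℚSeries.⊛-comm x y))
  (ℚ[[q]].trans (shiftUp-convˡ k y x) (ℚSeries.⊛-comm (shiftUp k y) x))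

qpowS-0≐δ : qpowS 0 ≐ ℚSeries.δ
qpowS-0≐δ zero    = ≡.refl
qpowS-0≐δ (suc i) = ≡.refl

module LaurentLaws where
  open ≐-Reasoning
  private
    S = shiftUp

  ≈L-trans : ∀ {a b c} → a ≈L b → b ≈L c → a ≈L c
  ≈L-trans {laurent α X} {laurent β Y} {laurent γ Z} p q = shiftUp-injective β (begin
    S β (S γ X)   ≈⟨ shiftUp-shiftUp-≡ β γ γ β X (ℕ.+-comm β γ) ⟩
    S γ (S β X)   ≈⟨ shiftUp-cong γ p ⟩
    S γ (S α Y)   ≈⟨ shiftUp-shiftUp-≡ γ α α γ Y (ℕ.+-comm γ α) ⟩
    S α (S γ Y)   ≈⟨ shiftUp-cong α q ⟩
    S α (S β Z)   ≈⟨ shiftUp-shiftUp-≡ α β β α Z (ℕ.+-comm α β) ⟩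
    S β (S α Z)   ∎)

  ≈L-isEquivalence : IsEquivalence _≈L_
  ≈L-isEquivalence = record
    { refl = λ n → ≡.refl
    ; sym = λ p n → ≡.sym (p n)
    ; trans = λ {a} {b} {c} → ≈L-trans {a} {b} {c}
    }

  +L-congʳ : ∀ {a a′} b → a ≈L a′ → (a +L b) ≈L (a′ +L b)
  +L-congʳ {laurent α X} {laurent α′ X′} (laurent β Y) p = begin
    S (α′ +ℕ β) (S β X ⊕ S α Y)
      ≈⟨ shiftUp-+ (α′ +ℕ β) (S β X) (S α Y) ⟩
    S (α′ +ℕ β) (S β X) ⊕ S (α′ +ℕ β) (S α Y)
      ≈⟨ ℚ[[q]].+-cong
           (ℚ[[q]].trans (shiftUp-shiftUp-≡ (α′ +ℕ β) β (β +ℕ β) α′ X (e₁ α′ β))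
           (ℚ[[q]].trans (shiftUp-cong (β +ℕ β) p) (shiftUp-shiftUp-≡ (β +ℕ β) α (α +ℕ β) β X′ (≡.sym (e₁ α β)))))
           (shiftUp-shiftUp-≡ (α′ +ℕ β) α (α +ℕ β) α′ Y (e₂ α α′ β)) ⟩
    S (α +ℕ β) (S β X′) ⊕ S (α +ℕ β) (S α′ Y)
      ≈⟨ shiftUp-+ (α +ℕ β) (S β X′) (S α′ Y) ⟨
    S (α +ℕ β) (S β X′ ⊕ S α′ Y)
      ∎
    where
    e₁ : ∀ a b → (a +ℕ b) +ℕ b ≡ (b +ℕ b) +ℕ a
    e₁ = solve-∀
    e₂ : ∀ a a′ b → (a′ +ℕ b) +ℕ a ≡ (a +ℕ b) +ℕ a′
    e₂ = solve-∀

  +L-comm : ∀ a b → (a +L b) ≈L (b +L a)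
  +L-comm (laurent α X) (laurent β Y) = begin
    S (β +ℕ α) (S β X ⊕ S α Y)   ≈⟨ shiftUp-cong (β +ℕ α) (λ n → ℚ.+-comm (S β X n) (S α Y n)) ⟩
    S (β +ℕ α) (S α Y ⊕ S β X)   ≈⟨ shiftUp-≡ _ (ℕ.+-comm β α) ⟩
    S (α +ℕ β) (S α Y ⊕ S β X)   ∎

  +L-assoc : ∀ a b c → ((a +L b) +L c) ≈L (a +L (b +L c))
  +L-assoc (laurent α X) (laurent β Y) (laurent γ Z) = begin
    S K (S γ (S β X ⊕ S α Y) ⊕ S (α +ℕ β) Z)
      ≈⟨ shiftUp-cong K (ℚ[[q]].+-congʳ (shiftUp-+ γ (S β X) (S α Y))) ⟩
    S K ((S γ (S β X) ⊕ S γ (S α Y)) ⊕ S (α +ℕ β) Z)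
      ≈⟨ shiftUp-cong K (ℚ[[q]].+-assoc (S γ (S β X)) (S γ (S α Y)) (S (α +ℕ β) Z)) ⟩
    S K (S γ (S β X) ⊕ (S γ (S α Y) ⊕ S (α +ℕ β) Z))
      ≈⟨ shiftUp-cong K (ℚ[[q]].+-cong (shiftUp-shiftUp-≡ γ β (β +ℕ γ) 0 X (e β γ))
           (ℚ[[q]].+-cong (shiftUp-shiftUp-≡ γ α α γ Y (ℕ.+-comm γ α)) (ℚ[[q]].sym (shiftUp-shiftUp α β Z)))) ⟩
    S K (S (β +ℕ γ) X ⊕ (S α (S γ Y) ⊕ S α (S β Z)))
      ≈⟨ shiftUp-cong K (ℚ[[q]].+-congˡ {S (β +ℕ γ) X} (shiftUp-+ α (S γ Y) (S β Z))) ⟨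
    S K (S (β +ℕ γ) X ⊕ S α (S γ Y ⊕ S β Z))
      ≈⟨ shiftUp-≡ _ (ℕ.+-assoc α β γ) ⟨
    S ((α +ℕ β) +ℕ γ) (S (β +ℕ γ) X ⊕ S α (S γ Y ⊕ S β Z))
      ∎
    where
    K = α +ℕ (β +ℕ γ)
    e : ∀ b c → c +ℕ b ≡ (b +ℕ c) +ℕ 0
    e = solve-∀

  +L-identityˡ : ∀ a → (0L +L a) ≈L a
  +L-identityˡ (laurent α X) = begin
    S α (S α ℚ[[q]].0# ⊕ X)   ≈⟨ shiftUp-cong α (ℚ[[q]].+-congʳ (shiftUp-0 α)) ⟩
    S α (ℚ[[q]].0# ⊕ X)       ≈⟨ shiftUp-cong α (ℚ[[q]].+-identityˡ X) ⟩
    S α X                     ∎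

  -L-cong : ∀ {a b} → a ≈L b → (-L a) ≈L (-L b)
  -L-cong {laurent α X} {laurent β Y} p =
    ℚ[[q]].trans (shiftUp-neg β X) (ℚ[[q]].trans (ℚ[[q]].-‿cong p) (ℚ[[q]].sym (shiftUp-neg α Y)))

  -L-inverseˡ : ∀ a → ((-L a) +L a) ≈L 0L
  -L-inverseˡ (laurent α X) = begin
    S α (ℚ[[q]].- X) ⊕ S α X          ≈⟨ ℚ[[q]].+-congʳ (shiftUp-neg α X) ⟩
    ℚ[[q]].- (S α X) ⊕ S α X          ≈⟨ ℚ[[q]].-‿inverseˡ (S α X) ⟩
    ℚ[[q]].0#                         ≈⟨ shiftUp-0 (α +ℕ α) ⟨
    S (α +ℕ α) ℚ[[q]].0#               ∎

  *L-congʳ : ∀ {a a′} b → a ≈L a′ → (a *L b) ≈L (a′ *L b)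
  *L-congʳ {laurent α X} {laurent α′ X′} (laurent β Y) p = begin
    S (α′ +ℕ β) (convS X Y)    ≈⟨ shiftUp-≡ _ (ℕ.+-comm α′ β) ⟩
    S (β +ℕ α′) (convS X Y)    ≈⟨ shiftUp-shiftUp β α′ _ ⟨
    S β (S α′ (convS X Y))    ≈⟨ shiftUp-cong β (shiftUp-convˡ α′ X Y) ⟩
    S β (convS (S α′ X) Y)    ≈⟨ shiftUp-cong β (ℚSeries.⊛-cong p (λ _ → ≡.refl)) ⟩
    S β (convS (S α X′) Y)    ≈⟨ shiftUp-cong β (shiftUp-convˡ α X′ Y) ⟨
    S β (S α (convS X′ Y))    ≈⟨ shiftUp-shiftUp β α _ ⟩
    S (β +ℕ α) (convS X′ Y)    ≈⟨ shiftUp-≡ _ (ℕ.+-comm β α) ⟩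
    S (α +ℕ β) (convS X′ Y)    ∎

  *L-comm : ∀ a b → (a *L b) ≈L (b *L a)
  *L-comm (laurent α X) (laurent β Y) =
    ℚ[[q]].trans (shiftUp-cong (β +ℕ α) (ℚSeries.⊛-comm X Y)) (shiftUp-≡ _ (ℕ.+-comm β α))

  *L-assoc : ∀ a b c → ((a *L b) *L c) ≈L (a *L (b *L c))
  *L-assoc (laurent α X) (laurent β Y) (laurent γ Z) =
    ℚ[[q]].trans (shiftUp-cong (α +ℕ (β +ℕ γ)) (ℚSeries.⊛-assoc X Y Z)) (shiftUp-≡ _ (≡.sym (ℕ.+-assoc α β γ)))

  *L-identityˡ : ∀ a → (1L *L a) ≈L a
  *L-identityˡ (laurent α X) =
    shiftUp-cong α (ℚ[[q]].trans (ℚSeries.⊛-cong {b = X} {b′ = X} qpowS-0≐δ (λ _ → ≡.refl)) (ℚSeries.⊛-identityˡ X))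

  *L-distribʳ : ∀ a b c → ((b +L c) *L a) ≈L ((b *L a) +L (c *L a))
  *L-distribʳ (laurent α X) (laurent β Y) (laurent γ Z) = begin
    S K (convS (S γ Y ⊕ S β Z) X)
      ≈⟨ shiftUp-cong K (ℚSeries.⊛-distribʳ (S γ Y) (S β Z) X) ⟩
    S K (convS (S γ Y) X ⊕ convS (S β Z) X)
      ≈⟨ shiftUp-+ K (convS (S γ Y) X) (convS (S β Z) X) ⟩
    S K (convS (S γ Y) X) ⊕ S K (convS (S β Z) X)
      ≈⟨ ℚ[[q]].+-cong
           (ℚ[[q]].trans (shiftUp-cong K (ℚ[[q]].sym (shiftUp-convˡ γ Y X)))
                         (shiftUp-shiftUp-≡ K γ K′ (γ +ℕ α) (convS Y X) (e₁ α β γ)))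
           (ℚ[[q]].trans (shiftUp-cong K (ℚ[[q]].sym (shiftUp-convˡ β Z X)))
                         (shiftUp-shiftUp-≡ K β K′ (β +ℕ α) (convS Z X) (e₂ α β γ))) ⟩
    S K′ (S (γ +ℕ α) (convS Y X)) ⊕ S K′ (S (β +ℕ α) (convS Z X))
      ≈⟨ shiftUp-+ K′ (S (γ +ℕ α) (convS Y X)) (S (β +ℕ α) (convS Z X)) ⟨
    S K′ (S (γ +ℕ α) (convS Y X) ⊕ S (β +ℕ α) (convS Z X))
      ∎
    where
    K = (β +ℕ α) +ℕ (γ +ℕ α)
    K′ = (β +ℕ γ) +ℕ α
    e₁ : ∀ a b c → ((b +ℕ a) +ℕ (c +ℕ a)) +ℕ c ≡ ((b +ℕ c) +ℕ a) +ℕ (c +ℕ a)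
    e₁ = solve-∀
    e₂ : ∀ a b c → ((b +ℕ a) +ℕ (c +ℕ a)) +ℕ b ≡ ((b +ℕ c) +ℕ a) +ℕ (b +ℕ a)
    e₂ = solve-∀

open LaurentLaws

≈L-setoid : Setoid 0ℓ 0ℓ
≈L-setoid = record { isEquivalence = ≈L-isEquivalence }

module ≈L-Reasoning = Relation.Binary.Reasoning.Setoid ≈L-setoid

+L-cong : ∀ {a a′ b b′} → a ≈L a′ → b ≈L b′ → (a +L b) ≈L (a′ +L b′)
+L-cong {a} {a′} {b} {b′} p q = begin
  a +L b     ≈⟨ +L-congʳ {a} {a′} b p ⟩
  a′ +L b    ≈⟨ +L-comm a′ b ⟩
  b +L a′    ≈⟨ +L-congʳ {b} {b′} a′ q ⟩
  b′ +L a′   ≈⟨ +L-comm b′ a′ ⟩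
  a′ +L b′   ∎
  where open ≈L-Reasoning

*L-cong : ∀ {a a′ b b′} → a ≈L a′ → b ≈L b′ → (a *L b) ≈L (a′ *L b′)
*L-cong {a} {a′} {b} {b′} p q = begin
  a *L b     ≈⟨ *L-congʳ {a} {a′} b p ⟩
  a′ *L b    ≈⟨ *L-comm a′ b ⟩
  b *L a′    ≈⟨ *L-congʳ {b} {b′} a′ q ⟩
  b′ *L a′   ≈⟨ *L-comm b′ a′ ⟩
  a′ *L b′   ∎
  where open ≈L-Reasoning

open Algebra.Consequences.Setoid ≈L-setoid
  using (comm∧idˡ⇒id; comm∧invˡ⇒inv; comm∧distrʳ⇒distr)

laurentRing : CommutativeRing 0ℓ 0ℓ
laurentRing = record
  { Carrier = Laurent
  ; _≈_ = _≈L_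
  ; _+_ = _+L_
  ; _*_ = _*L_
  ; -_ = -L_
  ; 0# = 0L
  ; 1# = 1L
  ; isCommutativeRing = record
    { isRing = record
      { +-isAbelianGroup = record
        { isGroup = record
          { isMonoid = record
            { isSemigroup = record
              { isMagma = record
                { isEquivalence = ≈L-isEquivalence
                ; ∙-cong = λ {a} {a′} {b} {b′} → +L-cong {a} {a′} {b} {b′} }
              ; assoc = +L-assoc }
            ; identity = comm∧idˡ⇒id {_∙_ = _+L_} +L-comm {0L} +L-identityˡ }
          ; inverse = comm∧invˡ⇒inv {_∙_ = _+L_} {_⁻¹ = -L_} {0L} +L-comm -L-inverseˡ
          ; ⁻¹-cong = λ {a} {b} → -L-cong {a} {b} }
        ; comm = +L-comm }
      ; *-cong = λ {a} {a′} {b} {b′} → *L-cong {a} {a′} {b} {b′}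
      ; *-assoc = *L-assoc
      ; *-identity = comm∧idˡ⇒id {_∙_ = _*L_} *L-comm {1L} *L-identityˡ
      ; distrib = comm∧distrʳ⇒distr {_∙_ = _*L_} {_◦_ = _+L_}
                    (λ {a} {a′} {b} {b′} → +L-cong {a} {a′} {b} {b′}) *L-comm *L-distribʳ }
    ; *-comm = *L-comm } }

𝕃 : CommutativeRing 0ℓ 0ℓ
𝕃 = wrapped laurentRing

module 𝕃 = CommutativeRing 𝕃

invList≡map-invS : ∀ (a : Ser) n → invList a n ≡ map (λ i → invS a (n ∸ i)) (upTo (suc n))
invList≡map-invS a zero = ≡.refl
invList≡map-invS a (suc n) = ≡.cong (invS a (suc n) ∷_) (begin
  invList a n                                         ≡⟨ invList≡map-invS a n ⟩
  map (λ i → invS a (n ∸ i)) (upTo (suc n))           ≡⟨ map-applyUpTo (λ i → i) _ (suc n) ⟩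
  applyUpTo (λ i → invS a (n ∸ i)) (suc n)            ≡⟨ map-applyUpTo suc _ (suc n) ⟨
  map (λ i → invS a (suc n ∸ i)) (applyUpTo suc (suc n)) ∎)
  where open ≡.≡-Reasoning

invS-suc : ∀ (a : Ser) n → invS a (suc n) ≡ -ℚ convS (a ∘ suc) (invS a) n
invS-suc a n = ≡.cong (λ l → -ℚ sumℚ l)
  (≡.trans (≡.cong (zipWith _ (upTo (suc n))) (invList≡map-invS a n)) (zipWith-map _ _ (upTo (suc n))))
  where
  zipWith-map : ∀ {A B C : Set} (g : A → B → C) (h : A → B) (xs : List A) →
    zipWith g xs (map h xs) ≡ map (λ x → g x (h x)) xs
  zipWith-map g h [] = ≡.refl
  zipWith-map g h (x ∷ xs) = ≡.cong (g x (h x) ∷_) (zipWith-map g h xs)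

module 𝕃-Reasoning = Relation.Binary.Reasoning.Setoid 𝕃.setoid

invS-inverse : ∀ (a : Ser) → a 0 ≡ 1ℚ → convS a (invS a) ≐ qpowS 0
invS-inverse a a0≡1 zero =
  ≡.trans (ℚ.+-identityʳ _) (≡.trans (≡.cong (_*ℚ 1ℚ) a0≡1) (ℚ.*-identityˡ 1ℚ))
invS-inverse a a0≡1 (suc n) = begin
  convS a (invS a) (suc n)                   ≡⟨ ℚSeries.⊛-suc a (invS a) n ⟩
  a 0 *ℚ invS a (suc n) +ℚ c                 ≡⟨ ≡.cong₂ (λ u v → u *ℚ v +ℚ c) a0≡1 (invS-suc a n) ⟩
  1ℚ *ℚ (-ℚ c) +ℚ c                          ≡⟨ ≡.cong (_+ℚ c) (ℚ.*-identityˡ (-ℚ c)) ⟩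
  -ℚ c +ℚ c                                  ≡⟨ ℚ.+-inverseˡ c ⟩
  0ℚ                                         ∎
  where
  open ≡.≡-Reasoning
  c = convS (a ∘ suc) (invS a) n

fromSer-invS : ∀ (a : Ser) → a 0 ≡ 1ℚ → (fromSer a *L fromSer (invS a)) 𝕃.≈ 1L
fromSer-invS a a0≡1 = wrap (invS-inverse a a0≡1)

qint*qintInv≈1 : ∀ n → (qintL (suc n) *L qintInvL (suc n)) 𝕃.≈ 1L
qint*qintInv≈1 n = fromSer-invS (qintS (suc n)) ≡.refl

qfact*qfactInv≈1 : ∀ k → (fromSer (qfactS k) *L qfactInvL k) 𝕃.≈ 1L
qfact*qfactInv≈1 k = fromSer-invS (qfactS k) (qfactS-0 k)
  where
  qfactS-0 : ∀ k → qfactS k 0 ≡ 1ℚ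
  qfactS-0 zero = ≡.refl
  qfactS-0 (suc k) =
    ≡.trans (ℚ.+-identityʳ _) (≡.trans (≡.cong (_*ℚ 1ℚ) (qfactS-0 k)) (ℚ.*-identityˡ 1ℚ))

-- By definition [k+1]_q! = [k]_q! [k+1]_q, so 1/[k+1]_q! · [k+1]_q is an inverse of [k]_q!.
qfactInv[1+k]*qint[1+k]≈qfactInv[k] : ∀ k → (qfactInvL (suc k) *L qintL (suc k)) 𝕃.≈ qfactInvL k
qfactInv[1+k]*qint[1+k]≈qfactInv[k] k = begin
  I′ *L Q                     ≈⟨ 𝕃.*-identityʳ (I′ *L Q) ⟨
  (I′ *L Q) *L 1L             ≈⟨ 𝕃.*-congˡ {I′ *L Q} (qfact*qfactInv≈1 k) ⟨
  (I′ *L Q) *L (F *L I)       ≈⟨ 𝕃.*-congʳ {F *L I} (𝕃.*-comm I′ Q) ⟩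
  (Q *L I′) *L (F *L I)       ≈⟨ interchange Q I′ F I ⟩
  (Q *L F) *L (I′ *L I)       ≈⟨ 𝕃.*-assoc (Q *L F) I′ I ⟨
  ((Q *L F) *L I′) *L I       ≈⟨ 𝕃.*-congʳ {I} (𝕃.*-congʳ {I′} (𝕃.*-comm Q F)) ⟩
  ((F *L Q) *L I′) *L I       ≈⟨ 𝕃.*-congʳ {I} (qfact*qfactInv≈1 (suc k)) ⟩
  1L *L I                     ≈⟨ 𝕃.*-identityˡ I ⟩
  I                           ∎
  where
  open 𝕃-Reasoning
  open Algebra.Properties.CommutativeSemigroup 𝕃.*-commutativeSemigroup using (interchange)
  I′ = qfactInvL (suc k)
  I = qfactInvL k
  Q = qintL (suc k)
  F = fromSer (qfactS k)

qpowS-0-⊛ : ∀ x → convS (qpowS 0) x ≐ x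
qpowS-0-⊛ x =
  ℚ[[q]].trans (ℚSeries.⊛-cong {b = x} {b′ = x} qpowS-0≐δ (λ _ → ≡.refl)) (ℚSeries.⊛-identityˡ x)

qpow[a]*qpow[b]≈qpow[a+b] : ∀ a b → (qpowL a *L qpowL b) 𝕃.≈ qpowL (a +ℕ b)
qpow[a]*qpow[b]≈qpow[a+b] a b = wrap (begin
  convS (shiftUp a δ′) (shiftUp b δ′)        ≈⟨ shiftUp-convˡ a δ′ (shiftUp b δ′) ⟨
  shiftUp a (convS δ′ (shiftUp b δ′))        ≈⟨ shiftUp-cong a (shiftUp-convʳ b δ′ δ′) ⟨
  shiftUp a (shiftUp b (convS δ′ δ′))        ≈⟨ shiftUp-cong a (shiftUp-cong b (qpowS-0-⊛ δ′)) ⟩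
  shiftUp a (shiftUp b δ′)                   ≈⟨ shiftUp-shiftUp a b δ′ ⟩
  shiftUp (a +ℕ b) δ′                         ∎)
  where
  open ≐-Reasoning
  δ′ = qpowS 0

qpow*qinvpow≈1 : ∀ k → (qpowL k *L qinvpowL k) 𝕃.≈ 1L
qpow*qinvpow≈1 k = wrap (ℚ[[q]].trans (ℚSeries.⊛-comm (qpowS k) (qpowS 0)) (qpowS-0-⊛ (qpowS k)))

1-q : Laurent
1-q = 1L +L (-L qpowL 1)

[1-q]*-≐ : ∀ x → convS (ser 1-q) x ≐ x ⊕ ℚ[[q]].- shiftUp 1 x
[1-q]*-≐ x = begin
  convS (δ′ ⊕ ℚ[[q]].- shiftUp 1 δ′) x
    ≈⟨ ℚSeries.⊛-distribʳ δ′ (ℚ[[q]].- shiftUp 1 δ′) x ⟩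
  convS δ′ x ⊕ convS (ℚ[[q]].- shiftUp 1 δ′) x
    ≈⟨ ℚ[[q]].+-cong (qpowS-0-⊛ x) (ℚ[[q]].sym (-‿distribˡ-* (shiftUp 1 δ′) x)) ⟩
  x ⊕ ℚ[[q]].- convS (shiftUp 1 δ′) x
    ≈⟨ ℚ[[q]].+-congˡ {x} (ℚ[[q]].-‿cong (shiftUp-convˡ 1 δ′ x)) ⟨
  x ⊕ ℚ[[q]].- shiftUp 1 (convS δ′ x)
    ≈⟨ ℚ[[q]].+-congˡ {x} (ℚ[[q]].-‿cong (shiftUp-cong 1 (qpowS-0-⊛ x))) ⟩
  x ⊕ ℚ[[q]].- shiftUp 1 x
    ∎
  where
  open ≐-Reasoning
  open Algebra.Properties.Ring ℚ[[q]].ring using (-‿distribˡ-*)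
  δ′ = qpowS 0

qint-telescope : ∀ n → qintS n ⊕ ℚ[[q]].- shiftUp 1 (qintS n) ≐ qpowS 0 ⊕ ℚ[[q]].- qpowS n
qint-telescope zero    zero    = ≡.refl
qint-telescope zero    (suc j) = ≡.refl
qint-telescope (suc n) j = begin
  qintS (suc n) j +ℚ -ℚ shiftUp 1 (qintS (suc n)) j
    ≡⟨ ≡.cong₂ (λ u v → u +ℚ -ℚ v) (qint-suc n j) (shiftUp-cong 1 (qint-suc n) j) ⟩
  (qintS n j +ℚ qpowS n j) +ℚ -ℚ shiftUp 1 (qintS n ⊕ qpowS n) j
    ≡⟨ ≡.cong (λ v → (qintS n j +ℚ qpowS n j) +ℚ -ℚ v) (shiftUp-+ 1 (qintS n) (qpowS n) j) ⟩
  (qintS n j +ℚ qpowS n j) +ℚ -ℚ (shiftUp 1 (qintS n) j +ℚ shiftUp 1 (qpowS n) j)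
    ≡⟨ regroup (qintS n j) (qpowS n j) (shiftUp 1 (qintS n) j) (shiftUp 1 (qpowS n) j) ⟩
  (qintS n j +ℚ -ℚ shiftUp 1 (qintS n) j) +ℚ (qpowS n j +ℚ -ℚ shiftUp 1 (qpowS n) j)
    ≡⟨ ≡.cong (_+ℚ (qpowS n j +ℚ -ℚ shiftUp 1 (qpowS n) j)) (qint-telescope n j) ⟩
  (qpowS 0 j +ℚ -ℚ qpowS n j) +ℚ (qpowS n j +ℚ -ℚ shiftUp 1 (qpowS n) j)
    ≡⟨ cancel (qpowS 0 j) (qpowS n j) (shiftUp 1 (qpowS n) j) ⟩
  qpowS 0 j +ℚ -ℚ shiftUp 1 (qpowS n) j
    ≡⟨ ≡.cong (λ v → qpowS 0 j +ℚ -ℚ v) (shiftUp-shiftUp 1 n (qpowS 0) j) ⟩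
  qpowS 0 j +ℚ -ℚ qpowS (suc n) j
    ∎
  where
  open ≡.≡-Reasoning
  open +-*-Solver
  qint-suc : ∀ n → qintS (suc n) ≐ qintS n ⊕ qpowS n
  qint-suc zero    zero    = ≡.refl
  qint-suc zero    (suc j) = ≡.refl
  qint-suc (suc n) zero    = ≡.sym (ℚ.+-identityʳ 1ℚ)
  qint-suc (suc n) (suc j) = qint-suc n j
  regroup : ∀ a b c d → (a +ℚ b) +ℚ -ℚ (c +ℚ d) ≡ (a +ℚ -ℚ c) +ℚ (b +ℚ -ℚ d)
  regroup = solve 4 (λ a b c d → (a :+ b) :+ :- (c :+ d) := (a :+ :- c) :+ (b :+ :- d)) ≡.refl
  cancel : ∀ a b c → (a +ℚ -ℚ b) +ℚ (b +ℚ -ℚ c) ≡ a +ℚ -ℚ c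
  cancel = solve 3 (λ a b c → (a :+ :- b) :+ (b :+ :- c) := a :+ :- c) ≡.refl

1-qⁿ≈[1-q]*qint : ∀ n → (1L +L (-L qpowL n)) 𝕃.≈ (1-q *L qintL n)
1-qⁿ≈[1-q]*qint n = wrap (ℚ[[q]].sym (ℚ[[q]].trans ([1-q]*-≐ (qintS n)) (qint-telescope n)))

geometric : Laurent
geometric = fromSer (λ _ → 1ℚ)

[1-q]*geometric≈1 : (1-q *L geometric) 𝕃.≈ 1L
[1-q]*geometric≈1 = wrap (ℚ[[q]].trans ([1-q]*-≐ (λ _ → 1ℚ))
  λ { zero → ≡.refl ; (suc j) → ℚ.+-inverseʳ 1ℚ })

[1-q]qint-invertible : ∀ n → ((geometric *L qintInvL (suc n)) *L (1-q *L qintL (suc n))) 𝕃.≈ 1L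
[1-q]qint-invertible n = begin
  (g *L I) *L (1-q *L Q)   ≈⟨ interchange g I 1-q Q ⟩
  (g *L 1-q) *L (I *L Q)   ≈⟨ 𝕃.*-cong (𝕃.*-comm g 1-q) (𝕃.*-comm I Q) ⟩
  (1-q *L g) *L (Q *L I)   ≈⟨ 𝕃.*-cong [1-q]*geometric≈1 (qint*qintInv≈1 n) ⟩
  1L *L 1L                 ≈⟨ 𝕃.*-identityˡ 1L ⟩
  1L                       ∎
  where
  open 𝕃-Reasoning
  open Algebra.Properties.CommutativeSemigroup 𝕃.*-commutativeSemigroup using (interchange)
  g = geometric
  I = qintInvL (suc n)
  Q = qintL (suc n)

sucC2 : ∀ k → suc k C 2 ≡ k C 2 +ℕ k
sucC2 k = ≡.trans (≡.sym (nCk+nC[k+1]≡[n+1]C[k+1] k 1))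
  (≡.trans (≡.cong (_+ℕ k C 2) (nC1≡n k)) (ℕ.+-comm k (k C 2)))

-- The coefficient ring 𝒜 = ℚ((q))[[Y]]

-- 𝕃[[y₀, …, y_{d-1}]]
multiSeries : ℕ → CommutativeRing 0ℓ 0ℓ
multiSeries zero    = 𝕃
multiSeries (suc d) = wrapped (PowerSeries.powerSeriesRing (multiSeries d))

module 𝕄 (d : ℕ) = CommutativeRing (multiSeries d)

coeff : ∀ d → 𝕄.Carrier d → Vec ℕ d → Laurent
coeff zero    x []      = x
coeff (suc d) x (k ∷ v) = coeff d (x k) v

fromCoeff : ∀ d → (Vec ℕ d → Laurent) → 𝕄.Carrier d
fromCoeff zero    h   = h []
fromCoeff (suc d) h k = fromCoeff d (λ v → h (k ∷ v))

coeff-fromCoeff : ∀ d h (v : Vec ℕ d) → coeff d (fromCoeff d h) v ≡ h v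
coeff-fromCoeff zero    h []      = ≡.refl
coeff-fromCoeff (suc d) h (k ∷ v) = coeff-fromCoeff d (λ w → h (k ∷ w)) v

coeff-cong : ∀ d {x y : 𝕄.Carrier d} → 𝕄._≈_ d x y → ∀ v → coeff d x v 𝕃.≈ coeff d y v
coeff-cong zero    p []      = p
coeff-cong (suc d) p (k ∷ v) = coeff-cong d (unwrap p k) v

coeff-injective : ∀ d {x y : 𝕄.Carrier d} → (∀ v → coeff d x v 𝕃.≈ coeff d y v) → 𝕄._≈_ d x y
coeff-injective zero    h = h []
coeff-injective (suc d) h = wrap (λ k → coeff-injective d (λ v → h (k ∷ v)))

coeff-+ : ∀ d (x y : 𝕄.Carrier d) v → coeff d (𝕄._+_ d x y) v ≡ coeff d x v +L coeff d y v
coeff-+ zero    x y []      = ≡.refl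
coeff-+ (suc d) x y (k ∷ v) = coeff-+ d (x k) (y k) v

coeff-0 : ∀ d v → coeff d (𝕄.0# d) v ≡ 0L
coeff-0 zero    []      = ≡.refl
coeff-0 (suc d) (k ∷ v) = coeff-0 d v

coeff-neg : ∀ d (x : 𝕄.Carrier d) v → coeff d (𝕄.-_ d x) v ≡ -L coeff d x v
coeff-neg zero    x []      = ≡.refl
coeff-neg (suc d) x (k ∷ v) = coeff-neg d (x k) v

coeff-sum : ∀ d {A : Set} (f : A → 𝕄.Carrier d) (xs : List A) v →
  coeff d (foldr (𝕄._+_ d) (𝕄.0# d) (map f xs)) v ≡ foldr _+L_ 0L (map (λ a → coeff d (f a) v) xs)
coeff-sum d f []       v = coeff-0 d v
coeff-sum d f (a ∷ xs) v = ≡.trans (coeff-+ d (f a) _ v) (≡.cong (coeff d (f a) v +L_) (coeff-sum d f xs v))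

scale : ∀ d → Laurent → 𝕄.Carrier d → 𝕄.Carrier d
scale zero    c x   = c *L x
scale (suc d) c x k = scale d c (x k)

coeff-scale : ∀ d c (x : 𝕄.Carrier d) v → coeff d (scale d c x) v ≡ c *L coeff d x v
coeff-scale zero    c x []      = ≡.refl
coeff-scale (suc d) c x (k ∷ v) = coeff-scale d c (x k) v

scale-cong : ∀ d c {x y : 𝕄.Carrier d} → 𝕄._≈_ d x y → 𝕄._≈_ d (scale d c x) (scale d c y)
scale-cong zero    c p = 𝕃.*-congˡ {c} p
scale-cong (suc d) c p = wrap (λ k → scale-cong d c (unwrap p k))

scale-+ : ∀ d c (x y : 𝕄.Carrier d) →
  𝕄._≈_ d (scale d c (𝕄._+_ d x y)) (𝕄._+_ d (scale d c x) (scale d c y))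
scale-+ zero    c x y = 𝕃.distribˡ c x y
scale-+ (suc d) c x y = wrap (λ k → scale-+ d c (x k) (y k))

scale-0 : ∀ d c → 𝕄._≈_ d (scale d c (𝕄.0# d)) (𝕄.0# d)
scale-0 zero    c = 𝕃.zeroʳ c
scale-0 (suc d) c = wrap (λ k → scale-0 d c)

scale-* : ∀ d c (x y : 𝕄.Carrier d) → 𝕄._≈_ d (scale d c (𝕄._*_ d x y)) (𝕄._*_ d (scale d c x) y)
scale-* zero    c x y = 𝕃.sym (𝕃.*-assoc c x y)
scale-* (suc d) c x y = wrap (λ n → 𝕄.sym d (⊛-•ˡ c x y n))
  where open PowerSeries.Action (multiSeries d) (scale d) (scale-cong d) (scale-+ d) (scale-0 d) (scale-* d)

strip-consS : ∀ k s → strip (consS k s) ≡ consS k (strip s)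
strip-consS zero    []       = ≡.refl
strip-consS zero    (y ∷ ys) = ≡.refl
strip-consS (suc k) s        = ≡.refl

strip-idem : ∀ m → strip (strip m) ≡ strip m
strip-idem []      = ≡.refl
strip-idem (k ∷ l) = ≡.trans (strip-consS k (strip l)) (≡.cong (consS k) (strip-idem l))

module 𝕃Series = PowerSeries 𝕃

sumL : List Laurent → Laurent
sumL = foldr _+L_ 0L

sumL-++ : ∀ (xs ys : List Laurent) → sumL (xs ++ ys) 𝕃.≈ sumL xs +L sumL ys
sumL-++ []       ys = 𝕃.sym (𝕃.+-identityˡ _)
sumL-++ (x ∷ xs) ys = 𝕃.trans (𝕃.+-congˡ {x} (sumL-++ xs ys)) (𝕃.sym (𝕃.+-assoc x _ _))

sumL-concatMap : ∀ {A B : Set} (h : B → Laurent) (g : A → List B) (xs : List A) →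
  sumL (map h (concatMap g xs)) 𝕃.≈ sumL (map (λ a → sumL (map h (g a))) xs)
sumL-concatMap h g []       = 𝕃.refl
sumL-concatMap h g (a ∷ xs) = begin
  sumL (map h (g a ++ concatMap g xs))
    ≡⟨ ≡.cong sumL (map-++ h (g a) (concatMap g xs)) ⟩
  sumL (map h (g a) ++ map h (concatMap g xs))
    ≈⟨ sumL-++ (map h (g a)) _ ⟩
  sumL (map h (g a)) +L sumL (map h (concatMap g xs))
    ≈⟨ 𝕃.+-congˡ {sumL (map h (g a))} (sumL-concatMap h g xs) ⟩
  sumL (map h (g a)) +L sumL (map (λ a → sumL (map h (g a))) xs)
    ∎
  where open 𝕃-Reasoning

slice : 𝒜 → ℕ → 𝒜
slice x i e = x (consS i e)

*A-cons : ∀ (x y : 𝒜) k l → (x *A y) (k ∷ l) 𝕃.≈ 𝕃Series.∑ (suc k) (λ i → (slice x i *A slice y (k ∸ i)) l)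
*A-cons x y k l = 𝕃.trans (sumL-concatMap term (λ i → map (cons-pair i) (splits l)) (upTo (suc k)))
  (𝕃.reflexive (≡.cong sumL (map-cong (λ i → ≡.cong sumL (≡.sym (map-∘ (splits l)))) (upTo (suc k)))))
  where
  term : List ℕ × List ℕ → Laurent
  term (e , f) = x (strip e) *L y (strip f)
  cons-pair : ℕ → List ℕ × List ℕ → List ℕ × List ℕ
  cons-pair i (e , f) = (i ∷ e , (k ∸ i) ∷ f)

*A-consS : ∀ (x y : 𝒜) k s → (x *A y) (consS k s) ≡ (x *A y) (k ∷ s)
*A-consS x y zero    []      = ≡.refl
*A-consS x y zero    (_ ∷ _) = ≡.refl
*A-consS x y (suc k) s       = ≡.refl

*A-strip : ∀ m (x y : 𝒜) → (x *A y) (strip m) 𝕃.≈ (x *A y) m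
*A-strip []      x y = 𝕃.refl
*A-strip (k ∷ l) x y = begin
  (x *A y) (consS k (strip l))                                 ≡⟨ *A-consS x y k (strip l) ⟩
  (x *A y) (k ∷ strip l)                                       ≈⟨ *A-cons x y k (strip l) ⟩
  𝕃Series.∑ (suc k) (λ i → (slice x i *A slice y (k ∸ i)) (strip l))
    ≈⟨ 𝕃Series.∑-cong (suc k) (λ i → *A-strip l (slice x i) (slice y (k ∸ i))) ⟩
  𝕃Series.∑ (suc k) (λ i → (slice x i *A slice y (k ∸ i)) l)           ≈⟨ *A-cons x y k l ⟨
  (x *A y) (k ∷ l)                                             ∎
  where open 𝕃-Reasoning

restrict : ∀ d → 𝒜 → 𝕄.Carrier d
restrict d x = fromCoeff d (λ v → x (strip (toList v)))

coeff-restrict : ∀ d x (v : Vec ℕ d) → coeff d (restrict d x) v ≡ x (strip (toList v))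
coeff-restrict d x v = coeff-fromCoeff d _ v

at-strip : ∀ (x : 𝒜) m → x (strip (strip m)) ≡ x (strip m)
at-strip x m = ≡.cong x (strip-idem m)

coeff-restrict-* : ∀ d (v : Vec ℕ d) x y →
  (x *A y) (toList v) 𝕃.≈ coeff d (𝕄._*_ d (restrict d x) (restrict d y)) v
coeff-restrict-* zero    []      x y = 𝕃.+-identityʳ _
coeff-restrict-* (suc d) (k ∷ v) x y = begin
  (x *A y) (k ∷ toList v)
    ≈⟨ *A-cons x y k (toList v) ⟩
  𝕃Series.∑ (suc k) (λ i → (slice x i *A slice y (k ∸ i)) (toList v))
    ≈⟨ 𝕃Series.∑-cong (suc k) (λ i → coeff-restrict-* d v (slice x i) (slice y (k ∸ i))) ⟩
  𝕃Series.∑ (suc k) (λ i → coeff d (𝕄._*_ d (restrict d (slice x i)) (restrict d (slice y (k ∸ i)))) v)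
    ≡⟨ coeff-sum d _ (upTo (suc k)) v ⟨
  coeff (suc d) (𝕄._*_ (suc d) (restrict (suc d) x) (restrict (suc d) y)) (k ∷ v)
    ∎
  where open 𝕃-Reasoning

restrict-≈ : ∀ d (x : 𝒜) (z : 𝕄.Carrier d) →
  (∀ v → x (strip (toList v)) 𝕃.≈ coeff d z v) → 𝕄._≈_ d (restrict d x) z
restrict-≈ d x z h = coeff-injective d {restrict d x} {z} λ v →
  𝕃.trans (𝕃.reflexive (coeff-restrict d x v)) (h v)

restrict-* : ∀ d x y → 𝕄._≈_ d (restrict d (x *A y)) (𝕄._*_ d (restrict d x) (restrict d y))
restrict-* d x y = restrict-≈ d (x *A y) _ λ v →
  𝕃.trans (*A-strip (toList v) x y) (coeff-restrict-* d v x y)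

restrict-+ : ∀ d x y → 𝕄._≈_ d (restrict d (x +A y)) (𝕄._+_ d (restrict d x) (restrict d y))
restrict-+ d x y = restrict-≈ d (x +A y) _ λ v → let m = toList v in 𝕃.reflexive (begin
  x (strip (strip m)) +L y (strip (strip m))
    ≡⟨ ≡.cong₂ _+L_ (at-strip x m) (at-strip y m) ⟩
  x (strip m) +L y (strip m)
    ≡⟨ ≡.cong₂ _+L_ (coeff-restrict d x v) (coeff-restrict d y v) ⟨
  coeff d (restrict d x) v +L coeff d (restrict d y) v
    ≡⟨ coeff-+ d (restrict d x) (restrict d y) v ⟨
  coeff d (𝕄._+_ d (restrict d x) (restrict d y)) v      ∎)
  where open ≡.≡-Reasoning

restrict-neg : ∀ d x → 𝕄._≈_ d (restrict d (-A x)) (𝕄.-_ d (restrict d x))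
restrict-neg d x = restrict-≈ d (-A x) _ λ v → let m = toList v in 𝕃.reflexive (begin
  -L x (strip (strip m))
    ≡⟨ ≡.cong -L_ (at-strip x m) ⟩
  -L x (strip m)
    ≡⟨ ≡.cong -L_ (coeff-restrict d x v) ⟨
  -L coeff d (restrict d x) v
    ≡⟨ coeff-neg d (restrict d x) v ⟨
  coeff d (𝕄.-_ d (restrict d x)) v  ∎)
  where open ≡.≡-Reasoning

restrict-scale : ∀ d c x → 𝕄._≈_ d (restrict d (c ·A x)) (scale d c (restrict d x))
restrict-scale d c x = restrict-≈ d (c ·A x) _ λ v → let m = toList v in 𝕃.reflexive (begin
  c *L x (strip (strip m))
    ≡⟨ ≡.cong (c *L_) (at-strip x m) ⟩
  c *L x (strip m)
    ≡⟨ ≡.cong (c *L_) (coeff-restrict d x v) ⟨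
  c *L coeff d (restrict d x) v
    ≡⟨ coeff-scale d c (restrict d x) v ⟨
  coeff d (scale d c (restrict d x)) v ∎)
  where open ≡.≡-Reasoning

restrict-0 : ∀ d → 𝕄._≈_ d (restrict d 0A) (𝕄.0# d)
restrict-0 d = restrict-≈ d 0A _ λ v → 𝕃.reflexive (≡.sym (coeff-0 d v))

oneAt : List ℕ → Laurent
oneAt []      = 1L
oneAt (_ ∷ _) = 0L

1A≡oneAt : ∀ m → 1A m ≡ oneAt (strip m)
1A≡oneAt m with strip m
... | []    = ≡.refl
... | _ ∷ _ = ≡.refl

coeff-1 : ∀ d (v : Vec ℕ d) → coeff d (𝕄.1# d) v ≡ oneAt (strip (toList v))
coeff-1 zero    []          = ≡.refl
coeff-1 (suc d) (zero ∷ v)  = ≡.trans (coeff-1 d v) (oneAt-consS0 (strip (toList v)))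
  where
  oneAt-consS0 : ∀ s → oneAt s ≡ oneAt (consS 0 s)
  oneAt-consS0 []      = ≡.refl
  oneAt-consS0 (_ ∷ _) = ≡.refl
coeff-1 (suc d) (suc k ∷ v) = coeff-0 d v

restrict-1 : ∀ d → 𝕄._≈_ d (restrict d 1A) (𝕄.1# d)
restrict-1 d = restrict-≈ d 1A _ λ v → let m = toList v in 𝕃.reflexive (begin
  1A (strip m)
    ≡⟨ 1A≡oneAt (strip m) ⟩
  oneAt (strip (strip m))
    ≡⟨ ≡.cong oneAt (strip-idem m) ⟩
  oneAt (strip m)
    ≡⟨ coeff-1 d v ⟨
  coeff d (𝕄.1# d) v          ∎)
  where open ≡.≡-Reasoning

restrict-cong : ∀ d {x y} → Wrap _≈A_ x y → 𝕄._≈_ d (restrict d x) (restrict d y)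
restrict-cong d {x} {y} p = restrict-≈ d x _ λ v →
  𝕃.trans (wrap (unwrap p (toList v))) (𝕃.reflexive (≡.sym (coeff-restrict d y v)))

-- An element of 𝒜 is determined by its restrictions: a monomial m involves
-- only the first length (strip m) indeterminates.
restrict-injective : ∀ {x y} → (∀ d → 𝕄._≈_ d (restrict d x) (restrict d y)) → Wrap _≈A_ x y
restrict-injective {x} {y} h = wrap λ m → unwrap (begin
  x (strip m)
    ≡⟨ at-canonical x m ⟩
  coeff (d m) (restrict (d m) x) (fromList (strip m))
  
    ≈⟨ coeff-cong (d m) (h (d m)) (fromList (strip m)) ⟩
  coeff (d m) (restrict (d m) y) (fromList (strip m))
  
    ≡⟨ at-canonical y m ⟨
  y (strip m)                    ∎)
  where
  open 𝕃-Reasoning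
  d : List ℕ → ℕ
  d m = length (strip m)
  at-canonical : ∀ z m → z (strip m) ≡ coeff (d m) (restrict (d m) z) (fromList (strip m))
  at-canonical z m = ≡.sym (≡.trans (coeff-restrict (d m) z (fromList (strip m)))
    (≡.trans (≡.cong (z ∘ strip) (toList∘fromList (strip m))) (at-strip z m)))

𝒜-rawRing : RawRing 0ℓ 0ℓ
𝒜-rawRing = record
  { Carrier = 𝒜 ; _≈_ = Wrap _≈A_ ; _+_ = _+A_ ; _*_ = _*A_ ; -_ = -A_ ; 0# = 0A ; 1# = 1A }

-- 𝒜 embeds into the product of the rings 𝕃[[y₀, …, y_{d-1}]], which
-- is how associativity of the product defined through 'splits' is obtained.
coefficientRing : CommutativeRing 0ℓ 0ℓ
coefficientRing = pullbackCommutativeRing (Π-commutativeRing multiSeries)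
  (mkIsRingMonomorphism {R = 𝒜-rawRing} (λ x d → restrict d x)
    (λ p d → restrict-cong d p) (λ x y d → restrict-+ d x y) restrict-0
    (λ x y d → restrict-* d x y) restrict-1 (λ x d → restrict-neg d x) restrict-injective)

module 𝔸 = CommutativeRing coefficientRing

module 𝔸-Reasoning = Relation.Binary.Reasoning.Setoid 𝔸.setoid

·A-at : ∀ c x m → (c ·A x) (strip m) ≡ c *L x (strip m)
·A-at c x m = ≡.cong (c *L_) (at-strip x m)

·A-at-strip : ∀ c x m → (c ·A x) (strip (strip m)) ≡ c *L x (strip m)
·A-at-strip c x m = ≡.trans (at-strip (c ·A x) m) (·A-at c x m)

pointwise : ∀ {a b : 𝒜} → (∀ m → a (strip m) 𝕃.≈ b (strip m)) → a 𝔸.≈ b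
pointwise h = wrap (λ m → unwrap (h m))

·A-cong : ∀ {c c′ x y} → c 𝕃.≈ c′ → x 𝔸.≈ y → (c ·A x) 𝔸.≈ (c′ ·A y)
·A-cong {c} {c′} {x} {y} p q = pointwise λ m →
  𝕃.trans (𝕃.reflexive (·A-at c x m))
    (𝕃.trans (𝕃.*-cong p (wrap (unwrap q m))) (𝕃.reflexive (≡.sym (·A-at c′ y m))))

·A-congˡ : ∀ c {x y} → x 𝔸.≈ y → (c ·A x) 𝔸.≈ (c ·A y)
·A-congˡ c = ·A-cong (𝕃.refl {c})

·A-congʳ : ∀ {c c′} x → c 𝕃.≈ c′ → (c ·A x) 𝔸.≈ (c′ ·A x)
·A-congʳ x p = ·A-cong p (𝔸.refl {x})

·A-assoc : ∀ c c′ x → (c ·A (c′ ·A x)) 𝔸.≈ ((c *L c′) ·A x)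
·A-assoc c c′ x = pointwise λ m → begin
  (c ·A (c′ ·A x)) (strip m)
    ≡⟨ ·A-at c (c′ ·A x) m ⟩
  c *L (c′ ·A x) (strip m)
    ≡⟨ ≡.cong (c *L_) (·A-at c′ x m) ⟩
  c *L (c′ *L x (strip m))
    ≈⟨ 𝕃.*-assoc c c′ (x (strip m)) ⟨
  (c *L c′) *L x (strip m)
    ≡⟨ ·A-at (c *L c′) x m ⟨
  ((c *L c′) ·A x) (strip m)
    ∎
  where open 𝕃-Reasoning

·A-distribʳ : ∀ c c′ x → ((c +L c′) ·A x) 𝔸.≈ ((c ·A x) +A (c′ ·A x))
·A-distribʳ c c′ x = pointwise λ m → begin
  ((c +L c′) ·A x) (strip m)                       ≡⟨ ·A-at (c +L c′) x m ⟩
  (c +L c′) *L x (strip m)                         ≈⟨ 𝕃.distribʳ (x (strip m)) c c′ ⟩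
  (c *L x (strip m)) +L (c′ *L x (strip m))        ≡⟨ ≡.cong₂ _+L_ (·A-at-strip c x m) (·A-at-strip c′ x m) ⟨
  (c ·A x) (strip (strip m)) +L (c′ ·A x) (strip (strip m)) ∎
  where open 𝕃-Reasoning

·A-distribˡ : ∀ c x y → (c ·A (x +A y)) 𝔸.≈ ((c ·A x) +A (c ·A y))
·A-distribˡ c x y = pointwise λ m → begin
  (c ·A (x +A y)) (strip m)
    ≡⟨ ·A-at c (x +A y) m ⟩
  c *L (x (strip (strip m)) +L y (strip (strip m)))
    ≡⟨ ≡.cong (c *L_) (≡.cong₂ _+L_ (at-strip x m) (at-strip y m)) ⟩
  c *L (x (strip m) +L y (strip m))
    ≈⟨ 𝕃.distribˡ c (x (strip m)) (y (strip m)) ⟩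
  (c *L x (strip m)) +L (c *L y (strip m))
    ≡⟨ ≡.cong₂ _+L_ (·A-at-strip c x m) (·A-at-strip c y m) ⟨
  (c ·A x) (strip (strip m)) +L (c ·A y) (strip (strip m))
    ∎
  where open 𝕃-Reasoning

·A-identity : ∀ x → (1L ·A x) 𝔸.≈ x
·A-identity x = pointwise λ m → 𝕃.trans (𝕃.reflexive (·A-at 1L x m)) (𝕃.*-identityˡ (x (strip m)))

·A-zero : ∀ c → (c ·A 0A) 𝔸.≈ 0A
·A-zero c = pointwise λ m → 𝕃.zeroʳ c

·A-negˡ : ∀ c x → ((-L c) ·A x) 𝔸.≈ (-A (c ·A x))
·A-negˡ c x = pointwise λ m → begin
  ((-L c) ·A x) (strip m)        ≡⟨ ·A-at (-L c) x m ⟩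
  (-L c) *L x (strip m)          ≈⟨ -‿distribˡ-* c (x (strip m)) ⟨
  -L (c *L x (strip m))          ≡⟨ ≡.cong -L_ (·A-at-strip c x m) ⟨
  -L (c ·A x) (strip (strip m))  ∎
  where
  open 𝕃-Reasoning
  open Algebra.Properties.Ring 𝕃.ring using (-‿distribˡ-*)

·A-negʳ : ∀ c x → (c ·A (-A x)) 𝔸.≈ (-A (c ·A x))
·A-negʳ c x = pointwise λ m → begin
  (c ·A (-A x)) (strip m)        ≡⟨ ·A-at c (-A x) m ⟩
  c *L (-L x (strip (strip m)))  ≡⟨ ≡.cong (λ z → c *L (-L z)) (at-strip x m) ⟩
  c *L (-L x (strip m))          ≈⟨ -‿distribʳ-* c (x (strip m)) ⟨
  -L (c *L x (strip m))          ≡⟨ ≡.cong -L_ (·A-at-strip c x m) ⟨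
  -L (c ·A x) (strip (strip m))  ∎
  where
  open 𝕃-Reasoning
  open Algebra.Properties.Ring 𝕃.ring using (-‿distribʳ-*)

·A-*ˡ : ∀ c x y → (c ·A (x *A y)) 𝔸.≈ ((c ·A x) *A y)
·A-*ˡ c x y = restrict-injective λ d → let open Relation.Binary.Reasoning.Setoid (𝕄.setoid d) in begin
  restrict d (c ·A (x *A y))                        ≈⟨ restrict-scale d c (x *A y) ⟩
  scale d c (restrict d (x *A y))                   ≈⟨ scale-cong d c (restrict-* d x y) ⟩
  scale d c (𝕄._*_ d (restrict d x) (restrict d y))  ≈⟨ scale-* d c _ _ ⟩
  𝕄._*_ d (scale d c (restrict d x)) (restrict d y)  ≈⟨ 𝕄.*-congʳ d (restrict-scale d c x) ⟨
  𝕄._*_ d (restrict d (c ·A x)) (restrict d y)       ≈⟨ restrict-* d (c ·A x) y ⟨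
  restrict d ((c ·A x) *A y)                        ∎

·A-*ʳ : ∀ c x y → (x *A (c ·A y)) 𝔸.≈ (c ·A (x *A y))
·A-*ʳ c x y = 𝔸.trans (𝔸.*-comm x (c ·A y)) (𝔸.trans (𝔸.sym (·A-*ˡ c y x)) (·A-congˡ c (𝔸.*-comm y x)))

-- Series in t over 𝒜

module 𝔸Series = PowerSeries coefficientRing
open 𝔸Series using (∑; _⊛_)

seriesRing : CommutativeRing 0ℓ 0ℓ
seriesRing = wrapped 𝔸Series.powerSeriesRing

module 𝕋 = CommutativeRing seriesRing
module 𝕋-Reasoning = Relation.Binary.Reasoning.Setoid 𝕋.setoid

open 𝔸Series.Action _·A_ ·A-congˡ ·A-distribˡ ·A-zero ·A-*ˡ

·T-congˡ : ∀ c {F G : T} → F 𝕋.≈ G → (c ·T F) 𝕋.≈ (c ·T G)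
·T-congˡ c p = wrap (λ n → ·A-congˡ c (unwrap p n))

·T-*ˡ : ∀ c (F G : T) → ((c ·T F) *T G) 𝕋.≈ (c ·T (F *T G))
·T-*ˡ c F G = wrap (⊛-•ˡ c F G)

·T-distrib : ∀ c (F G : T) → (c ·T (F 𝕋.+ G)) 𝕋.≈ ((c ·T F) 𝕋.+ (c ·T G))
·T-distrib c F G = wrap (λ n → ·A-distribˡ c (F n) (G n))

·T-zero : ∀ c → (c ·T 𝕋.0#) 𝕋.≈ 𝕋.0#
·T-zero c = wrap (λ n → ·A-zero c)

t·_ : T → T
(t· F) zero    = 0A
(t· F) (suc n) = F n

t·-cong : ∀ {F G} → F 𝕋.≈ G → (t· F) 𝕋.≈ (t· G)
t·-cong p = wrap λ { zero → 𝔸.refl ; (suc n) → unwrap p n }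

t·-distrib : ∀ F G → (t· (F 𝕋.+ G)) 𝕋.≈ ((t· F) 𝕋.+ (t· G))
t·-distrib F G = wrap λ { zero → 𝔸.sym (𝔸.+-identityˡ 0A) ; (suc n) → 𝔸.refl }

t·-zero : (t· 𝕋.0#) 𝕋.≈ 𝕋.0#
t·-zero = wrap λ { zero → 𝔸.refl ; (suc n) → 𝔸.refl }

t·-*ˡ : ∀ F G → ((t· F) *T G) 𝕋.≈ (t· (F *T G))
t·-*ˡ F G = wrap λ
  { zero    → 𝔸.trans (𝔸.+-identityʳ _) (𝔸.zeroˡ (G 0))
  ; (suc n) → 𝔸.trans (𝔸.reflexive (𝔸Series.⊛-suc (t· F) G n))
                (𝔸.trans (𝔸.+-congʳ {(F ⊛ G) n} (𝔸.zeroˡ (G (suc n)))) (𝔸.+-identityˡ _)) }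

·A-*-·A : ∀ a b x y → ((a ·A x) *A (b ·A y)) 𝔸.≈ ((a *L b) ·A (x *A y))
·A-*-·A a b x y = begin
  (a ·A x) *A (b ·A y)     ≈⟨ ·A-*ˡ a x (b ·A y) ⟨
  a ·A (x *A (b ·A y))     ≈⟨ ·A-congˡ a (·A-*ʳ b x y) ⟩
  a ·A (b ·A (x *A y))     ≈⟨ ·A-assoc a b (x *A y) ⟩
  (a *L b) ·A (x *A y)     ∎
  where open 𝔸-Reasoning

dil-* : ∀ F G → dil (F *T G) 𝕋.≈ (dil F *T dil G)
dil-* F G = wrap λ n → 𝔸.sym (begin
  (dil F ⊛ dil G) n
    ≈⟨ 𝔸Series.∑-cong-< (suc n) (λ i i<1+n → 𝔸.trans (·A-*-·A (qpowL i) (qpowL (n ∸ i)) (F i) (G (n ∸ i)))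
         (·A-congʳ (F i *A G (n ∸ i)) (𝕃.trans (qpow[a]*qpow[b]≈qpow[a+b] i (n ∸ i))
           (𝕃.reflexive (≡.cong qpowL (m+[n∸m]≡n (s≤s⁻¹ i<1+n))))))) ⟩
  ∑ (suc n) (λ i → qpowL n ·A (F i *A G (n ∸ i)))
    ≈⟨ ∑-• (suc n) (qpowL n) (λ i → F i *A G (n ∸ i)) ⟩
  qpowL n ·A (F ⊛ G) n
    ∎)
  where open 𝔸-Reasoning

[1-q]t·_ : T → T
[1-q]t· F = 1-q ·T (t· F)

[1-q]t·-cong : ∀ {F G} → F 𝕋.≈ G → ([1-q]t· F) 𝕋.≈ ([1-q]t· G)
[1-q]t·-cong p = ·T-congˡ 1-q (t·-cong p)

[1-q]t·-*ˡ : ∀ F G → (([1-q]t· F) *T G) 𝕋.≈ ([1-q]t· (F *T G))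
[1-q]t·-*ˡ F G = 𝕋.trans (·T-*ˡ 1-q (t· F) G) (·T-congˡ 1-q (t·-*ˡ F G))

[1-q]t·-distrib : ∀ F G → ([1-q]t· (F 𝕋.+ G)) 𝕋.≈ (([1-q]t· F) 𝕋.+ ([1-q]t· G))
[1-q]t·-distrib F G = 𝕋.trans (·T-congˡ 1-q (t·-distrib F G)) (·T-distrib 1-q (t· F) (t· G))

[1-q]t·-zero : ([1-q]t· 𝕋.0#) 𝕋.≈ 𝕋.0#
[1-q]t·-zero = 𝕋.trans (·T-congˡ 1-q t·-zero) (·T-zero 1-q)

[1-qⁿ]·A : ∀ n x → (x +A (-A (qpowL n ·A x))) 𝔸.≈ ((1-q *L qintL n) ·A x)
[1-qⁿ]·A n x = begin
  x +A (-A (qpowL n ·A x))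
    ≈⟨ 𝔸.+-cong (𝔸.sym (·A-identity x)) (𝔸.sym (·A-negˡ (qpowL n) x)) ⟩
  (1L ·A x) +A ((-L qpowL n) ·A x)
    ≈⟨ ·A-distribʳ 1L (-L qpowL n) x ⟨
  (1L +L (-L qpowL n)) ·A x
    ≈⟨ ·A-congʳ x (1-qⁿ≈[1-q]*qint n) ⟩
  (1-q *L qintL n) ·A x
    ∎
  where open 𝔸-Reasoning

F-dilF≈[1-q]t·DqF : ∀ F → (F 𝕋.- dil F) 𝕋.≈ ([1-q]t· Dq F)
F-dilF≈[1-q]t·DqF F = wrap λ
  { zero    → 𝔸.trans (𝔸.+-congˡ {F 0} (𝔸.-‿cong (·A-identity (F 0))))
                (𝔸.trans (𝔸.-‿inverseʳ (F 0)) (𝔸.sym (·A-zero 1-q)))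
  ; (suc n) → 𝔸.trans ([1-qⁿ]·A (suc n) (F (suc n)))
                (𝔸.sym (·A-assoc 1-q (qintL (suc n)) (F (suc n)))) }

Dq-neg : ∀ F → Dq (-T F) 𝕋.≈ (𝕋.- Dq F)
Dq-neg F = wrap λ n → ·A-negʳ (qintL (suc n)) (F (suc n))

-- The q-analogue of the product rule: (A B)(t) - (A B)(qt) splits into the
-- two differences, and D_q A · B(qt) + A · D_q B = A B(qt) (h + g) vanishes.
product-dil-invariant : ∀ A B g h →
  Dq A 𝕋.≈ (A *T h) → Dq B 𝕋.≈ (dil B *T g) → (g 𝕋.+ h) 𝕋.≈ 𝕋.0# →
  ((A *T B) 𝕋.- dil (A *T B)) 𝕋.≈ 𝕋.0#
product-dil-invariant A B g h DqA DqB g+h≈0 = begin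
  A * B - dil (A * B)
    ≈⟨ 𝕋.+-congˡ {A * B} (𝕋.-‿cong (dil-* A B)) ⟩
  A * B - dil A * dil B
    ≈⟨ *-difference seriesRing A B (dil A) (dil B) ⟩
  A * (B - dil B) + (A - dil A) * dil B
    ≈⟨ 𝕋.+-cong (𝕋.*-congˡ {A} (F-dilF≈[1-q]t·DqF B)) (𝕋.*-congʳ {dil B} (F-dilF≈[1-q]t·DqF A)) ⟩
  A * ([1-q]t· Dq B) + ([1-q]t· Dq A) * dil B
    ≈⟨ 𝕋.+-cong (𝕋.trans (𝕋.*-comm A ([1-q]t· Dq B)) ([1-q]t·-*ˡ (Dq B) A)) ([1-q]t·-*ˡ (Dq A) (dil B)) ⟩
  [1-q]t· (Dq B * A) + [1-q]t· (Dq A * dil B)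
    ≈⟨ [1-q]t·-distrib (Dq B * A) (Dq A * dil B) ⟨
  [1-q]t· (Dq B * A + Dq A * dil B)
    ≈⟨ [1-q]t·-cong (𝕋.+-cong (𝕋.*-congʳ {A} DqB) (𝕋.*-congʳ {dil B} DqA)) ⟩
  [1-q]t· ((dil B * g) * A + (A * h) * dil B)
    ≈⟨ [1-q]t·-cong rearrange ⟩
  [1-q]t· ((A * dil B) * (g + h))
    ≈⟨ [1-q]t·-cong (𝕋.trans (𝕋.*-congˡ {A * dil B} g+h≈0) (𝕋.zeroʳ (A * dil B))) ⟩
  [1-q]t· 𝕋.0#
    ≈⟨ [1-q]t·-zero ⟩
  𝕋.0#
    ∎
  where
  open 𝕋-Reasoning
  open 𝕋 using (_+_; _*_; _-_)
  rearrange : ((dil B * g) * A + (A * h) * dil B) 𝕋.≈ ((A * dil B) * (g + h))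
  rearrange = begin
    (dil B * g) * A + (A * h) * dil B
      ≈⟨ 𝕋.+-cong (𝕋.*-comm (dil B * g) A) (𝕋.trans (𝕋.*-assoc A h (dil B)) (𝕋.*-congˡ {A} (𝕋.*-comm h (dil B)))) ⟩
    A * (dil B * g) + A * (dil B * h)
      ≈⟨ 𝕋.distribˡ A (dil B * g) (dil B * h) ⟨
    A * (dil B * g + dil B * h)
      ≈⟨ 𝕋.*-congˡ {A} (𝕋.distribˡ (dil B) g h) ⟨
    A * (dil B * (g + h))
      ≈⟨ 𝕋.*-assoc A (dil B) (g + h) ⟨
    (A * dil B) * (g + h)
      ∎

dil-invariant⇒constant : ∀ W → (W 𝕋.- dil W) 𝕋.≈ 𝕋.0# → ∀ n → W (suc n) 𝔸.≈ 0A
dil-invariant⇒constant W W-dilW≈0 n = begin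
  x
    ≈⟨ ·A-identity x ⟨
  1L ·A x
    ≈⟨ ·A-congʳ x ([1-q]qint-invertible n) ⟨
  (ι *L c) ·A x
    ≈⟨ ·A-assoc ι c x ⟨
  ι ·A (c ·A x)
    ≈⟨ ·A-congˡ ι (𝔸.trans (𝔸.sym ([1-qⁿ]·A (suc n) x)) (unwrap W-dilW≈0 (suc n))) ⟩
  ι ·A 0A
    ≈⟨ ·A-zero ι ⟩
  0A
    ∎
  where
  open 𝔸-Reasoning
  x = W (suc n)
  ι = geometric *L qintInvL (suc n)
  c = 1-q *L qintL (suc n)

-- q-compositions

VanishesBelow : (ℕ → T) → Set
VanishesBelow P = ∀ k n → n < k → P k n 𝔸.≈ 0A

Iq-vanishes : ∀ c (X Y : T) k → (∀ n → n < k → X n 𝔸.≈ 0A) →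
  ∀ n → n < suc k → Iq (c ·T (X *T Y)) n 𝔸.≈ 0A
Iq-vanishes c X Y k X<k≈0 zero    _           = 𝔸.refl
Iq-vanishes c X Y k X<k≈0 (suc n) (s≤s n<k) = begin
  qintInvL (suc n) ·A (c ·A (X ⊛ Y) n)            ≈⟨ ·A-congˡ (qintInvL (suc n)) (·A-congˡ c X⊛Y≈0) ⟩
  qintInvL (suc n) ·A (c ·A 0A)                   ≈⟨ ·A-congˡ (qintInvL (suc n)) (·A-zero c) ⟩
  qintInvL (suc n) ·A 0A                          ≈⟨ ·A-zero (qintInvL (suc n)) ⟩
  0A                                              ∎
  where
  open 𝔸-Reasoning
  X⊛Y≈0 : (X ⊛ Y) n 𝔸.≈ 0A
  X⊛Y≈0 = 𝔸.trans
    (𝔸Series.⊛-cong-≤ n {b = Y} {b′ = Y} (λ i i≤n → X<k≈0 i (≤-<-trans i≤n n<k)) (λ _ _ → 𝔸.refl))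
    (𝔸Series.⊛-zeroˡ Y n)

qpow-vanishes : ∀ F → VanishesBelow (qpow F)
qpow-vanishes F zero    n ()
qpow-vanishes F (suc k) = Iq-vanishes (qintL (suc k)) (qpow F k) (Dq F) k (qpow-vanishes F k)

dil-vanishes : ∀ {X : T} k → (∀ n → n < k → X n 𝔸.≈ 0A) → ∀ n → n < k → dil X n 𝔸.≈ 0A
dil-vanishes {X} k X<k≈0 n n<k = 𝔸.trans (·A-congˡ (qpowL n) (X<k≈0 n n<k)) (·A-zero (qpowL n))

qpow*-vanishes : ∀ F → VanishesBelow (qpow* F)
qpow*-vanishes F zero    n ()
qpow*-vanishes F (suc k) = Iq-vanishes (qintL (suc k) *L qinvpowL k) (dil (qpow* F k)) (Dq F) k
  (dil-vanishes k (qpow*-vanishes F k))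

-- ∑_k d_k P_k, where in degree n only k ≤ n contribute; 'comp' and 'comp*' are of this form.
∑T : (ℕ → Laurent) → (ℕ → T) → T
∑T d P n = ∑ (suc n) (λ k → d k ·A P k n)

_/[k]! : (ℕ → Laurent) → ℕ → Laurent
(g /[k]!) k = g k *L qfactInvL k

∑T-*ʳ : ∀ d P Y → VanishesBelow P → (∑T d P *T Y) 𝕋.≈ ∑T d (λ k → P k *T Y)
∑T-*ʳ d P Y P-vanishes = wrap λ n → begin
  ((λ i → ∑ (suc i) (λ k → d k ·A P k i)) ⊛ Y) n
    ≈⟨ 𝔸Series.⊛-cong-≤ n {b = Y} {b′ = Y} (λ i i≤n → 𝔸Series.∑-extend (suc i) (suc n) (λ k → d k ·A P k i)
         (λ k i<k → 𝔸.trans (·A-congˡ (d k) (P-vanishes k i i<k)) (·A-zero (d k))) (s≤s i≤n)) (λ _ _ → 𝔸.refl) ⟩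
  ((λ i → ∑ (suc n) (λ k → d k ·A P k i)) ⊛ Y) n
    ≈⟨ 𝔸Series.⊛-∑ˡ (suc n) (λ k i → d k ·A P k i) Y n ⟩
  ∑ (suc n) (λ k → ((λ i → d k ·A P k i) ⊛ Y) n)
    ≈⟨ 𝔸Series.∑-cong (suc n) (λ k → ⊛-•ˡ (d k) (P k) Y n) ⟩
  ∑ (suc n) (λ k → d k ·A (P k ⊛ Y) n)
    ∎
  where open 𝔸-Reasoning

∑T-dil : ∀ d P → ∑T d (dil ∘ P) 𝕋.≈ dil (∑T d P)
∑T-dil d P = wrap λ n → 𝔸.trans (𝔸Series.∑-cong (suc n) (λ k → swap (d k) (qpowL n) (P k n)))
                                  (∑-• (suc n) (qpowL n) (λ k → d k ·A P k n))
  where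
  swap : ∀ c c′ x → (c ·A (c′ ·A x)) 𝔸.≈ (c′ ·A (c ·A x))
  swap c c′ x =
    𝔸.trans (·A-assoc c c′ x) (𝔸.trans (·A-congʳ x (𝕃.*-comm c c′)) (𝔸.sym (·A-assoc c′ c x)))

qint-cancel : ∀ n D S → (qintL (suc n) *L (D *L (qintInvL (suc n) *L S))) 𝕃.≈ (D *L S)
qint-cancel n D S = begin
  Q *L (D *L (I *L S))    ≈⟨ 𝕃.*-congˡ {Q} (x∙yz≈y∙xz D I S) ⟩
  Q *L (I *L (D *L S))    ≈⟨ 𝕃.*-assoc Q I (D *L S) ⟨
  (Q *L I) *L (D *L S)    ≈⟨ 𝕃.*-congʳ {D *L S} (qint*qintInv≈1 n) ⟩
  1L *L (D *L S)          ≈⟨ 𝕃.*-identityˡ (D *L S) ⟩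
  D *L S                  ∎
  where
  open 𝕃-Reasoning
  open Algebra.Properties.CommutativeSemigroup 𝕃.*-commutativeSemigroup using (x∙yz≈y∙xz)
  Q = qintL (suc n)
  I = qintInvL (suc n)

Dq-∑T : ∀ (d s : ℕ → Laurent) (P R : ℕ → T) →
  (∀ n → P 0 (suc n) 𝔸.≈ 0A) →
  (∀ j n → P (suc j) (suc n) 𝔸.≈ (qintInvL (suc n) ·A (s j ·A R j n))) →
  (∀ j → (d (suc j) *L s j) 𝕃.≈ d j) →
  Dq (∑T d P) 𝕋.≈ ∑T d R
Dq-∑T d s P R P₀≈0 P-step d-step = wrap λ n → let Q = qintL (suc n) ; f = λ k → d k ·A P k (suc n) in begin
  Q ·A ∑ (suc (suc n)) f                      ≡⟨ ≡.cong (Q ·A_) (𝔸Series.∑-suc (suc n) f) ⟩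
  Q ·A (f 0 +A ∑ (suc n) (f ∘ suc))          ≈⟨ ·A-congˡ Q (𝔸.trans (𝔸.+-congʳ {∑ (suc n) (f ∘ suc)}
                                                 (𝔸.trans (·A-congˡ (d 0) (P₀≈0 n)) (·A-zero (d 0))))
                                                 (𝔸.+-identityˡ (∑ (suc n) (f ∘ suc)))) ⟩
  Q ·A ∑ (suc n) (f ∘ suc)                    ≈⟨ ∑-• (suc n) Q (f ∘ suc) ⟨
  ∑ (suc n) (λ j → Q ·A f (suc j))            ≈⟨ 𝔸Series.∑-cong (suc n) (term n) ⟩
  ∑ (suc n) (λ j → d j ·A R j n)              ∎
  where
  open 𝔸-Reasoning
  term : ∀ n j → (qintL (suc n) ·A (d (suc j) ·A P (suc j) (suc n))) 𝔸.≈ (d j ·A R j n)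
  term n j = begin
    Q ·A (D ·A P (suc j) (suc n))     ≈⟨ ·A-congˡ Q (·A-congˡ D (P-step j n)) ⟩
    Q ·A (D ·A (I ·A (S ·A X)))        ≈⟨ ·A-congˡ Q (·A-congˡ D (·A-assoc I S X)) ⟩
    Q ·A (D ·A ((I *L S) ·A X))        ≈⟨ ·A-congˡ Q (·A-assoc D (I *L S) X) ⟩
    Q ·A ((D *L (I *L S)) ·A X)        ≈⟨ ·A-assoc Q (D *L (I *L S)) X ⟩
    (Q *L (D *L (I *L S))) ·A X        ≈⟨ ·A-congʳ X (𝕃.trans (qint-cancel n D S) (d-step j)) ⟩
    d j ·A X                           ∎
    where
    Q = qintL (suc n)
    I = qintInvL (suc n)
    D = d (suc j)
    S = s j
    X = R j n

e-coeff-step : ∀ j → ((e-coeff /[k]!) (suc j) *L qintL (suc j)) 𝕃.≈ (e-coeff /[k]!) j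
e-coeff-step j = 𝕃.trans (𝕃.*-assoc 1L (qfactInvL (suc j)) (qintL (suc j)))
                         (𝕃.*-congˡ {1L} (qfactInv[1+k]*qint[1+k]≈qfactInv[k] j))

E-coeff-step : ∀ j → ((E-coeff /[k]!) (suc j) *L (qintL (suc j) *L qinvpowL j)) 𝕃.≈ (E-coeff /[k]!) j
E-coeff-step j = begin
  (P′ *L I′) *L (Q *L q⁻ʲ)       ≈⟨ 𝕃.*-congˡ {P′ *L I′} (𝕃.*-comm Q q⁻ʲ) ⟩
  (P′ *L I′) *L (q⁻ʲ *L Q)       ≈⟨ interchange P′ I′ q⁻ʲ Q ⟩
  (P′ *L q⁻ʲ) *L (I′ *L Q)       ≈⟨ 𝕃.*-cong P′q⁻ʲ≈P (qfactInv[1+k]*qint[1+k]≈qfactInv[k] j) ⟩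
  qpowL (j C 2) *L qfactInvL j   ∎
  where
  open 𝕃-Reasoning
  open Algebra.Properties.CommutativeSemigroup 𝕃.*-commutativeSemigroup using (interchange)
  P′ = qpowL (suc j C 2)
  I′ = qfactInvL (suc j)
  Q = qintL (suc j)
  q⁻ʲ = qinvpowL j
  P′q⁻ʲ≈P : (P′ *L q⁻ʲ) 𝕃.≈ qpowL (j C 2)
  P′q⁻ʲ≈P = begin
    P′ *L q⁻ʲ                           ≡⟨ ≡.cong (λ z → qpowL z *L q⁻ʲ) (sucC2 j) ⟩
    qpowL (j C 2 +ℕ j) *L q⁻ʲ            ≈⟨ 𝕃.*-congʳ {q⁻ʲ} (qpow[a]*qpow[b]≈qpow[a+b] (j C 2) j) ⟨
    (qpowL (j C 2) *L qpowL j) *L q⁻ʲ   ≈⟨ 𝕃.*-assoc (qpowL (j C 2)) (qpowL j) q⁻ʲ ⟩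
    qpowL (j C 2) *L (qpowL j *L q⁻ʲ)   ≈⟨ 𝕃.*-congˡ {qpowL (j C 2)} (qpow*qinvpow≈1 j) ⟩
    qpowL (j C 2) *L 1L                 ≈⟨ 𝕃.*-identityʳ (qpowL (j C 2)) ⟩
    qpowL (j C 2)                       ∎

Dq-e[H] : ∀ H → Dq (comp e-coeff H) 𝕋.≈ (comp e-coeff H *T Dq H)
Dq-e[H] H = 𝕋.trans
  (Dq-∑T (e-coeff /[k]!) (qintL ∘ suc) (qpow H) (λ j → qpow H j *T Dq H)
         (λ _ → 𝔸.refl) (λ _ _ → 𝔸.refl) e-coeff-step)
  (𝕋.sym (∑T-*ʳ (e-coeff /[k]!) (qpow H) (Dq H) (qpow-vanishes H)))

Dq-E*[G] : ∀ G → Dq (comp* E-coeff G) 𝕋.≈ (dil (comp* E-coeff G) *T Dq G)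
Dq-E*[G] G = begin
  Dq (comp* E-coeff G)
    ≈⟨ Dq-∑T d (λ j → qintL (suc j) *L qinvpowL j) (qpow* G) (λ j → dil (qpow* G j) *T Dq G)
             (λ _ → 𝔸.refl) (λ _ _ → 𝔸.refl) E-coeff-step ⟩
  ∑T d (λ j → dil (qpow* G j) *T Dq G)
    ≈⟨ ∑T-*ʳ d (dil ∘ qpow* G) (Dq G) (λ k → dil-vanishes k (qpow*-vanishes G k)) ⟨
  ∑T d (dil ∘ qpow* G) *T Dq G
    ≈⟨ 𝕋.*-congʳ {Dq G} (∑T-dil d (qpow* G)) ⟩
  dil (comp* E-coeff G) *T Dq G
    ∎
  where
  open 𝕋-Reasoning
  d = E-coeff /[k]!

∑T-at-0 : ∀ d P → d 0 𝕃.≈ 1L → P 0 0 𝔸.≈ 1A → ∑T d P 0 𝔸.≈ 1A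
∑T-at-0 d P d₀≈1 P₀₀≈1 =
  𝔸.trans (𝔸.+-identityʳ (d 0 ·A P 0 0)) (𝔸.trans (·A-cong d₀≈1 P₀₀≈1) (·A-identity 1A))

e[H]*E*[G]≈1 : ∀ G H → (Dq G 𝕋.+ Dq H) 𝕋.≈ 𝕋.0# → (comp e-coeff H *T comp* E-coeff G) 𝕋.≈ 1T
e[H]*E*[G]≈1 G H DqG+DqH≈0 = wrap λ
  { zero    → 𝔸.trans (𝔸.+-identityʳ (A 0 *A B 0)) (𝔸.trans (𝔸.*-cong A₀≈1 B₀≈1) (𝔸.*-identityˡ 1A))
  ; (suc n) → dil-invariant⇒constant (A *T B)
                (product-dil-invariant A B (Dq G) (Dq H) (Dq-e[H] H) (Dq-E*[G] G) DqG+DqH≈0) n }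
  where
  A = comp e-coeff H
  B = comp* E-coeff G
  A₀≈1 : A 0 𝔸.≈ 1A
  A₀≈1 = ∑T-at-0 (e-coeff /[k]!) (qpow H) (qfact*qfactInv≈1 0) 𝔸.refl
  B₀≈1 : B 0 𝔸.≈ 1A
  B₀≈1 = ∑T-at-0 (E-coeff /[k]!) (qpow* G) (qfact*qfactInv≈1 0) 𝔸.refl

proposition8p6 : (f : BQT) → (∀ j m → f 0 j (strip m) ≡ 0ℚ) →
    ((comp e-coeff (-T embed f) *T comp* E-coeff (embed f)) ≈T 1T)
    × ((comp* E-coeff (-T embed f) *T comp e-coeff (embed f)) ≈T 1T)
proposition8p6 f _ = pointwiseT (e[H]*E*[G]≈1 F (-T F) DqF+Dq[-F]≈0)
                   , pointwiseT (𝕋.trans (𝕋.*-comm (comp* E-coeff (-T F)) (comp e-coeff F))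
                                         (e[H]*E*[G]≈1 (-T F) F Dq[-F]+DqF≈0))
  where
  F = embed f
  pointwiseT : ∀ {X Y} → X 𝕋.≈ Y → X ≈T Y
  pointwiseT p n = unwrap (unwrap p n)
  DqF+Dq[-F]≈0 : (Dq F 𝕋.+ Dq (-T F)) 𝕋.≈ 𝕋.0#
  DqF+Dq[-F]≈0 = 𝕋.trans (𝕋.+-congˡ {Dq F} (Dq-neg F)) (𝕋.-‿inverseʳ (Dq F))
  Dq[-F]+DqF≈0 : (Dq (-T F) 𝕋.+ Dq F) 𝕋.≈ 𝕋.0#
  Dq[-F]+DqF≈0 = 𝕋.trans (𝕋.+-congʳ {Dq F} (Dq-neg F)) (𝕋.-‿inverseˡ (Dq F))
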